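{- Let $T$ be a recursively bridge-mirrored tree with $2^k$ vertices whose recursive cutting results in $(T_0=T,T_1,\dots,T_k=T_{\mathrm{rc}})$. Then for each $1\le i\le k$, $2^{k-i}$ is the largest power of $2$ that divides the number of vertices in a branch of $T$ cut from an edge in $E(T_{i-1})\setminus E(T_i)$.
   Context: All graphs are undirected. A tree is recursively bridge-mirrored if it can be built by: (i) the one-vertex tree is; (ii) if $T$ is, choose a root vertex, take two identical copies of the rooted tree and join the two roots by an edge. An automorphism of a graph is odd if, for some (equivalently any) orientation, it reverses an odd number of edges; a graph is odd if it has an odd automorphism and even otherwise. An edge of a tree is a mirror-bridge if some automorphism swaps its endpoints; an odd tree has a unique mirror-bridge. Recursive cutting: for a forest $F$, $F_0=F$ and $F_{i+1}$ is obtained from $F_i$ by removing the mirror-bridge of each odd component of $F_i$ (keeping all vertices); $F_{\mathrm{rc}}$ is the even forest at which it stabilizes. For an edge $uv$ of a tree $T$, the branch of $T$ cut from $uv$ is the rooted tree $(B,v)$ where $B$ is the component of $T\setminus uv$ containing $v$. -}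

module Defs where

open import Data.Nat using (ℕ; zero; suc; _+_; _≡ᵇ_; _<ᵇ_; _%_)
open import Data.Bool using (Bool; true; false; _∧_; _∨_; not; if_then_else_)
open import Data.Fin using (Fin; toℕ; splitAt)
open import Data.Sum using (inj₁; inj₂)
open import Data.List using (List; allFin; foldr)
open import Data.Bool.ListAction using (any)
import Data.List
open import Data.Product using (Σ; _×_; ∃)
open import Data.Fin.Permutation using (Permutation′; _⟨$⟩ʳ_)
open import Relation.Binary.PropositionalEquality using (_≡_)
open import Relation.Nullary using (¬_)

-- A graph on vertex set Fin n, given by a Boolean adjacency relation.
-- (All graphs arising below are symmetric and loopless.)
Graph : ℕ → Set
Graph n = Fin n → Fin n → Bool

_==_ : ∀ {n} → Fin n → Fin n → Bool
a == b = toℕ a ≡ᵇ toℕ b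

countV : ∀ {n} → (Fin n → Bool) → ℕ
countV {n} p = foldr (λ x acc → (if p x then 1 else 0) + acc) 0 (allFin n)

double : ∀ {m} → Graph m → Fin m → Graph (m + m)
double {m} G r u v with splitAt m u | splitAt m v
... | inj₁ a | inj₁ b = G a b
... | inj₂ a | inj₂ b = G a b
... | inj₁ a | inj₂ b = (a == r) ∧ (b == r)
... | inj₂ a | inj₁ b = (a == r) ∧ (b == r)

data RBM : (n : ℕ) → Graph n → Set where
  rbm-one  : (G : Graph 1) → (∀ u v → G u v ≡ false) → RBM 1 G
  rbm-dbl  : ∀ {m} {G : Graph m} → RBM m G → (r : Fin m) → RBM (m + m) (double G r)
  rbm-iso  : ∀ {n} {G H : Graph n} → RBM n G → (σ : Permutation′ n) →
             (∀ u v → H u v ≡ G (σ ⟨$⟩ʳ u) (σ ⟨$⟩ʳ v)) → RBM n H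

reachWithin : ∀ {n} → ℕ → Graph n → Fin n → Fin n → Bool
reachWithin zero    F u w = u == w
reachWithin (suc k) F u w =
  reachWithin k F u w ∨ any (λ x → reachWithin k F u x ∧ F x w) (allFin _)

-- u and w lie in the same connected component (walks of length ≤ n suffice)
reachable : ∀ {n} → Graph n → Fin n → Fin n → Bool
reachable {n} F = reachWithin n F

removeEdge : ∀ {n} → Graph n → Fin n → Fin n → Graph n
removeEdge F u v a b = F a b ∧ not ((a == u ∧ b == v) ∨ (a == v ∧ b == u))

branchSize : ∀ {n} → Graph n → Fin n → Fin n → ℕ
branchSize T u v = countV (reachable (removeEdge T u v) v)

IsAut : ∀ {n} → Graph n → Permutation′ n → Set
IsAut F σ = ∀ u v → F (σ ⟨$⟩ʳ u) (σ ⟨$⟩ʳ v) ≡ F u v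

-- number of edges reversed by σ, w.r.t. the orientation u → v for toℕ u < toℕ v
reversedCount : ∀ {n} → Graph n → Permutation′ n → ℕ
reversedCount F σ =
  foldr _+_ 0 (Data.List.map (λ u → countV (λ v →
     F u v ∧ (toℕ u <ᵇ toℕ v) ∧ (toℕ (σ ⟨$⟩ʳ v) <ᵇ toℕ (σ ⟨$⟩ʳ u)))) (allFin _))

-- σ is an automorphism of the connected component of F containing a
-- (encoded as an automorphism of F fixing every vertex outside it)
IsCompAut : ∀ {n} → Graph n → Fin n → Permutation′ n → Set
IsCompAut F a σ = IsAut F σ × (∀ w → reachable F a w ≡ false → σ ⟨$⟩ʳ w ≡ w)

OddComp : ∀ {n} → Graph n → Fin n → Set
OddComp F a = Σ (Permutation′ _) (λ σ → IsCompAut F a σ × (reversedCount F σ % 2 ≡ 1))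

MirrorBridge : ∀ {n} → Graph n → Fin n → Fin n → Set
MirrorBridge F a b = (F a b ≡ true) ×
  Σ (Permutation′ _) (λ σ → IsCompAut F a σ × (σ ⟨$⟩ʳ a ≡ b) × (σ ⟨$⟩ʳ b ≡ a))

CutStep : ∀ {n} → Graph n → Graph n → Set
CutStep F F' = ∀ a b →
  ((F' a b ≡ true) → (F a b ≡ true) × ¬ (OddComp F a × MirrorBridge F a b)) ×
  ((F a b ≡ true) × ¬ (OddComp F a × MirrorBridge F a b) → F' a b ≡ true)

-- Give every edge of a recursively bridge-mirrored tree a level: the bridge joining the two
-- copies in the last doubling has level 1, and doubling raises the levels inside each copy
-- by 1. For each j, the edges of level > j form a forest whose components have 2^(k-j)
-- vertices. In it, an edge of level j + 1 is swapped by an involutive automorphism of its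
-- component that flips no other edge onto itself; the other reversed edges pair up, so
-- the component is odd and this edge is its mirror-bridge. An edge of level ℓ ≥ j + 2 has a
-- branch of size 2^(k-ℓ) modulo 2^(k-ℓ+1), so it does not halve its component and is no
-- mirror-bridge. Hence step i of the recursive cutting removes exactly the edges of level i,
-- and their branches have size 2^(k-i) modulo 2^(k-i+1).

module Submission where

open import Defs

open import Data.Bool using (Bool; true; false; _∧_; _∨_; not; if_then_else_)
open import Data.Bool.Properties
  using (∧-conicalˡ; ∧-conicalʳ; ∨-conicalˡ; ∨-conicalʳ; ∨-zeroʳ; ∧-comm; ∧-zeroʳ; not-injective; T-≡; ⇔→≡)
open import Data.Bool.ListAction using (any)
open import Data.Empty using (⊥; ⊥-elim)
open import Data.Fin using (Fin; zero; suc; toℕ; splitAt; join; _↑ˡ_; _↑ʳ_)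
open import Data.Fin.Permutation
  using (Permutation′; _⟨$⟩ʳ_; _⟨$⟩ˡ_; permutation; inverseˡ; inverseʳ) renaming (id to idₚ)
open import Data.Fin.Properties
  using (toℕ-injective; splitAt-↑ˡ; splitAt-↑ʳ; splitAt⁻¹-↑ˡ; splitAt⁻¹-↑ʳ; ↑ˡ-injective; ↑ʳ-injective)
open import Data.List using (foldr; tabulate; allFin)
open import Data.List.Properties using (foldr-map)
open import Data.List.Membership.Propositional.Properties using (∈-allFin)
import Data.List.Relation.Unary.Any as Any
open import Data.List.Relation.Unary.Any using (satisfied)
open import Data.List.Relation.Unary.Any.Properties using (any⁺; any⁻)
open import Data.Nat
  using (ℕ; zero; suc; _+_; _*_; _∸_; _^_; _≤_; _<_; z≤n; s≤s; _≡ᵇ_; _<ᵇ_; _%_; >-nonZero;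
         _≤′_; ≤′-refl; ≤′-step)
open import Data.Nat.DivMod using ([m+kn]%n≡m%n)
open import Data.Nat.Divisibility
  using (_∣_; divides; ∣-refl; ∣-trans; ∣m∣n⇒∣m+n; ∣m+n∣m⇒∣n; ∣n⇒∣m*n; n∣m*n; >⇒∤)
open import Data.Nat.Properties
open import Data.Nat.Solver using (module +-*-Solver)
open import Data.Product using (∃; _×_; _,_; proj₁; proj₂)
open import Data.Sum using (_⊎_; inj₁; inj₂; [_,_]′)
import Data.Sum
open import Function.Bundles using (mk⇔; Equivalence)
open import Relation.Binary.Definitions using (Tri; tri<; tri≈; tri>)
open import Relation.Binary.PropositionalEquality
open import Relation.Nullary using (¬_)
import Algebra.Properties.CommutativeMonoid.Sum as CommutativeMonoidSum
open CommutativeMonoidSum +-0-commutativeMonoid using (sum; sum-cong-≗; ∑-comm; ∑-permute; ∑-distrib-+)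

∧-true⇒ : ∀ {a b} → a ∧ b ≡ true → (a ≡ true) × (b ≡ true)
∧-true⇒ e = ∧-conicalˡ _ _ e , ∧-conicalʳ _ _ e

true≢false : true ≢ false
true≢false ()

bool-ext : ∀ {a b : Bool} → (a ≡ true → b ≡ true) → (b ≡ true → a ≡ true) → a ≡ b
bool-ext f g = ⇔→≡ (mk⇔ f g)

==⇒≡ : ∀ {n} {a b : Fin n} → (a == b) ≡ true → a ≡ b
==⇒≡ {a = a} {b} e = toℕ-injective (≡ᵇ⇒≡ (toℕ a) (toℕ b) (Equivalence.from T-≡ e))

≡⇒== : ∀ {n} {a b : Fin n} → a ≡ b → (a == b) ≡ true
≡⇒== {a = a} refl = Equivalence.to T-≡ (≡⇒≡ᵇ (toℕ a) (toℕ a) refl)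

==-refl : ∀ {n} (a : Fin n) → (a == a) ≡ true
==-refl a = ≡⇒== {a = a} refl

==-injective : ∀ {n n′} (f : Fin n → Fin n′) → (∀ {x y} → f x ≡ f y → x ≡ y) →
  ∀ x y → (f x == f y) ≡ (x == y)
==-injective f f-injective x y =
  bool-ext (λ e → ≡⇒== (f-injective (==⇒≡ e))) (λ e → ≡⇒== (cong f (==⇒≡ e)))

any-allFin⇒ : ∀ {n} (p : Fin n → Bool) → any p (allFin n) ≡ true → ∃ λ x → p x ≡ true
any-allFin⇒ p e with satisfied (any⁻ p (allFin _) (Equivalence.from T-≡ e))
... | x , px = x , Equivalence.to T-≡ px

⇒any-allFin : ∀ {n} (p : Fin n → Bool) (x : Fin n) → p x ≡ true → any p (allFin n) ≡ true
⇒any-allFin p x px =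
  Equivalence.to T-≡ (any⁺ p (Any.map (λ { refl → Equivalence.from T-≡ px }) (∈-allFin x)))

⊆-or-witness : ∀ {n} (p q : Fin n → Bool) →
  (∀ w → p w ≡ true → q w ≡ true) ⊎ ∃ λ w → (p w ≡ true) × (q w ≡ false)
⊆-or-witness {zero} p q = inj₁ (λ ())
⊆-or-witness {suc n} p q with ⊆-or-witness (λ i → p (suc i)) (λ i → q (suc i)) | p zero in ep | q zero in eq
... | inj₂ (w , pw , qw) | _ | _ = inj₂ (suc w , pw , qw)
... | inj₁ h | true | false = inj₂ (zero , ep , eq)
... | inj₁ h | true | true = inj₁ λ { zero _ → eq ; (suc w) → h w }
... | inj₁ h | false | _ = inj₁ λ { zero e → ⊥-elim (true≢false (trans (sym e) ep)) ; (suc w) → h w }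

𝟙 : Bool → ℕ
𝟙 b = if b then 1 else 0

count : ∀ {n} → (Fin n → Bool) → ℕ
count p = sum (λ i → 𝟙 (p i))

foldr-tabulate : ∀ {A : Set} {n} (f : Fin n → A) (g : A → ℕ) →
  foldr (λ x acc → g x + acc) 0 (tabulate f) ≡ sum (λ i → g (f i))
foldr-tabulate {n = zero} f g = refl
foldr-tabulate {n = suc n} f g = cong (g (f zero) +_) (foldr-tabulate (λ i → f (suc i)) g)

countV≡count : ∀ {n} (p : Fin n → Bool) → countV p ≡ count p
countV≡count p = foldr-tabulate (λ i → i) (λ x → 𝟙 (p x))

count-cong : ∀ {n} {p q : Fin n → Bool} → (∀ i → p i ≡ q i) → count p ≡ count q
count-cong h = sum-cong-≗ (λ i → cong 𝟙 (h i))

𝟙-mono : ∀ {a b} → (a ≡ true → b ≡ true) → 𝟙 a ≤ 𝟙 b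
𝟙-mono {true} h rewrite h refl = ≤-refl
𝟙-mono {false} h = z≤n

count≤ : ∀ {n} (p : Fin n → Bool) → count p ≤ n
count≤ {zero} p = z≤n
count≤ {suc n} p = +-mono-≤ (𝟙-mono {b = true} (λ _ → refl)) (count≤ (λ i → p (suc i)))

sum-mono : ∀ {n} {f g : Fin n → ℕ} → (∀ i → f i ≤ g i) → sum f ≤ sum g
sum-mono {zero} h = z≤n
sum-mono {suc n} h = +-mono-≤ (h zero) (sum-mono (λ i → h (suc i)))

sum-mono-< : ∀ {n} {f g : Fin n → ℕ} → (∀ i → f i ≤ g i) → (w : Fin n) → f w < g w →
  sum f < sum g
sum-mono-< {suc n} h zero lt = +-mono-<-≤ lt (sum-mono (λ i → h (suc i)))
sum-mono-< {suc n} h (suc w) lt = +-mono-≤-< (h zero) (sum-mono-< (λ i → h (suc i)) w lt)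

count-mono-< : ∀ {n} {p q : Fin n → Bool} → (∀ i → p i ≡ true → q i ≡ true) →
  (w : Fin n) → q w ≡ true → p w ≡ false → count p < count q
count-mono-< {p = p} {q} h w qw pw = sum-mono-< (λ i → 𝟙-mono (h i)) w 𝟙pw<𝟙qw
  where
  𝟙pw<𝟙qw : 𝟙 (p w) < 𝟙 (q w)
  𝟙pw<𝟙qw rewrite qw | pw = s≤s z≤n

count-const : ∀ n c → count {n} (λ _ → c) ≡ n * 𝟙 c
count-const zero c = refl
count-const (suc n) c = cong (𝟙 c +_) (count-const n c)

sum-↑ : ∀ a {b} (f : Fin (a + b) → ℕ) → sum f ≡ sum (λ i → f (i ↑ˡ b)) + sum (λ i → f (a ↑ʳ i))
sum-↑ zero f = refl
sum-↑ (suc a) f = trans (cong (f zero +_) (sum-↑ a (λ i → f (suc i)))) (sym (+-assoc (f zero) _ _))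

count-↑ : ∀ a {b} (p : Fin (a + b) → Bool) → count p ≡ count (λ i → p (i ↑ˡ b)) + count (λ i → p (a ↑ʳ i))
count-↑ a p = sum-↑ a (λ i → 𝟙 (p i))

count-pos : ∀ {n} (p : Fin n → Bool) (w : Fin n) → p w ≡ true → 0 < count p
count-pos {n} p w pw = subst (_< count p) (trans (count-const n false) (*-zeroʳ n))
  (count-mono-< (λ _ ()) w pw refl)

data Walk {n} (F : Graph n) (u : Fin n) : Fin n → Set where
  nil  : Walk F u u
  snoc : ∀ {x w} → Walk F u x → F x w ≡ true → Walk F u w

reachWithin-step : ∀ {n} (F : Graph n) k {u x w} → reachWithin k F u x ≡ true → F x w ≡ true →
  reachWithin (suc k) F u w ≡ true
reachWithin-step F k {u} {x} {w} r e
  rewrite ⇒any-allFin (λ y → reachWithin k F u y ∧ F y w) x (cong₂ _∧_ r e) =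
  ∨-zeroʳ (reachWithin k F u w)

reachWithin-suc⇒ : ∀ {n} (F : Graph n) k {u w} → reachWithin (suc k) F u w ≡ true →
  (reachWithin k F u w ≡ true) ⊎ ∃ λ x → (reachWithin k F u x ≡ true) × (F x w ≡ true)
reachWithin-suc⇒ F k {u} {w} e with reachWithin k F u w in eq
... | true = inj₁ refl
... | false with any-allFin⇒ (λ x → reachWithin k F u x ∧ F x w) e
... | x , h = inj₂ (x , ∧-true⇒ h)

reachWithin⇒Walk : ∀ {n} (F : Graph n) k {u w} → reachWithin k F u w ≡ true → Walk F u w
reachWithin⇒Walk F zero {u} e = subst (Walk F u) (==⇒≡ e) nil
reachWithin⇒Walk F (suc k) e with reachWithin-suc⇒ F k e
... | inj₁ h = reachWithin⇒Walk F k h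
... | inj₂ (x , h , e′) = snoc (reachWithin⇒Walk F k h) e′

Walk⇒reachWithin : ∀ {n} {F : Graph n} {u w} → Walk F u w → ∃ λ k → reachWithin k F u w ≡ true
Walk⇒reachWithin {u = u} nil = 0 , ==-refl u
Walk⇒reachWithin {F = F} (snoc p e) with Walk⇒reachWithin p
... | k , h = suc k , reachWithin-step F k h e

reachWithin-mono : ∀ {n} (F : Graph n) {k k′ u w} → k ≤ k′ → reachWithin k F u w ≡ true →
  reachWithin k′ F u w ≡ true
reachWithin-mono F k≤k′ = go (≤⇒≤′ k≤k′)
  where
  go : ∀ {k k′ u w} → k ≤′ k′ → reachWithin k F u w ≡ true → reachWithin k′ F u w ≡ true
  go ≤′-refl e = e
  go (≤′-step k≤′k′) e rewrite go k≤′k′ e = refl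

module _ {n} (F : Graph n) (u : Fin n) where
  private
    R : ℕ → Fin n → Bool
    R k = reachWithin k F u

  Stable : ℕ → Set
  Stable j = ∀ w → R (suc j) w ≡ true → R j w ≡ true

  stable⇒saturated : ∀ {j} → Stable j → ∀ d w → R (d + j) w ≡ true → R j w ≡ true
  stable⇒saturated st zero w e = e
  stable⇒saturated {j} st (suc d) w e with reachWithin-suc⇒ F (d + j) e
  ... | inj₁ h = stable⇒saturated st d w h
  ... | inj₂ (x , rx , e′) = st w (reachWithin-step F j (stable⇒saturated st d x rx) e′)

  -- Pigeonhole: the sets R k grow strictly until they stabilise, and have at most n elements.
  stable-or-large : ∀ k → (∃ λ j → j ≤ k × Stable j) ⊎ (k < count (R k))
  stable-or-large zero = inj₂ (count-pos (R 0) u (==-refl u))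
  stable-or-large (suc k) with stable-or-large k
  ... | inj₁ (j , j≤k , st) = inj₁ (j , m≤n⇒m≤1+n j≤k , st)
  ... | inj₂ k<count with ⊆-or-witness (R (suc k)) (R k)
  ... | inj₁ st = inj₁ (k , n≤1+n k , st)
  ... | inj₂ (w , new , old) = inj₂ (<-≤-trans (s≤s k<count)
          (count-mono-< (λ i → reachWithin-mono F (n≤1+n k)) w new old))

  reachWithin⇒reachable : ∀ k w → R k w ≡ true → reachable F u w ≡ true
  reachWithin⇒reachable k w e with stable-or-large n
  ... | inj₂ n<count = ⊥-elim (<⇒≱ n<count (count≤ (R n)))
  ... | inj₁ (j , j≤n , st) = reachWithin-mono F j≤n
        (stable⇒saturated st k w (reachWithin-mono F (m≤m+n k j) e))

Walk⇒reachable : ∀ {n} {F : Graph n} {u w} → Walk F u w → reachable F u w ≡ true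
Walk⇒reachable {F = F} {u} {w} p with Walk⇒reachWithin p
... | k , h = reachWithin⇒reachable F u k w h

reachable⇒Walk : ∀ {n} {F : Graph n} {u w} → reachable F u w ≡ true → Walk F u w
reachable⇒Walk {n} {F} = reachWithin⇒Walk F n

reachable-step : ∀ {n} {F : Graph n} {u x w} → reachable F u x ≡ true → F x w ≡ true →
  reachable F u w ≡ true
reachable-step {F = F} r e = Walk⇒reachable (snoc (reachable⇒Walk {F = F} r) e)

walk-++ : ∀ {n} {F : Graph n} {u x w} → Walk F u x → Walk F x w → Walk F u w
walk-++ p nil = p
walk-++ p (snoc q e) = snoc (walk-++ p q) e

walk-cons : ∀ {n} {F : Graph n} {u x w} → F u x ≡ true → Walk F x w → Walk F u w
walk-cons e nil = snoc nil e
walk-cons e (snoc p e′) = snoc (walk-cons e p) e′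

walk-reverse : ∀ {n} {F : Graph n} → (∀ x y → F x y ≡ F y x) → ∀ {u w} → Walk F u w → Walk F w u
walk-reverse sym-F nil = nil
walk-reverse sym-F (snoc p e) = walk-cons (trans (sym-F _ _) e) (walk-reverse sym-F p)

walk-map : ∀ {n n′} {F : Graph n} {G : Graph n′} (f : Fin n → Fin n′) →
  (∀ x y → F x y ≡ true → G (f x) (f y) ≡ true) → ∀ {u w} → Walk F u w → Walk G (f u) (f w)
walk-map f h nil = nil
walk-map f h (snoc p e) = snoc (walk-map f h p) (h _ _ e)

walk-closed : ∀ {n} {F : Graph n} (P : Fin n → Bool) →
  (∀ x y → P x ≡ true → F x y ≡ true → P y ≡ true) →
  ∀ {u w} → P u ≡ true → Walk F u w → P w ≡ true
walk-closed P closed pu nil = pu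
walk-closed P closed pu (snoc p e) = closed _ _ (walk-closed P closed pu p) e

reachable-char : ∀ {n} (F : Graph n) (P : Fin n → Bool) (b : Fin n) → P b ≡ true →
  (∀ x y → P x ≡ true → F x y ≡ true → P y ≡ true) →
  (∀ x → P x ≡ true → Walk F b x) → ∀ x → reachable F b x ≡ P x
reachable-char F P b pb closed walk x =
  bool-ext (λ e → walk-closed P closed pb (reachable⇒Walk e)) (λ e → Walk⇒reachable (walk x e))

_≃[_]_ : ∀ {n} → Graph n → Permutation′ n → Graph n → Set
H ≃[ π ] G = ∀ u v → H u v ≡ G (π ⟨$⟩ʳ u) (π ⟨$⟩ʳ v)

involution : ∀ {n} (s : Fin n → Fin n) → (∀ x → s (s x) ≡ x) → Permutation′ n
involution s inv = permutation s s inv inv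

module _ {n} (π : Permutation′ n) where
  private
    s = π ⟨$⟩ʳ_
    s⁻ = π ⟨$⟩ˡ_

  ⟨$⟩ʳ-injective : ∀ {x y} → s x ≡ s y → x ≡ y
  ⟨$⟩ʳ-injective {x} {y} e = trans (sym (inverseˡ π)) (trans (cong s⁻ e) (inverseˡ π))

  ==-permute : ∀ x y → (s x == s y) ≡ (x == y)
  ==-permute = ==-injective s ⟨$⟩ʳ-injective

  sum-permute : (f : Fin n → ℕ) → sum (λ i → f (s i)) ≡ sum f
  sum-permute f = sym (∑-permute f π)

  count-permute : (p q : Fin n → Bool) → (∀ x → p x ≡ q (s x)) → count p ≡ count q
  count-permute p q h = trans (count-cong h) (sum-permute (λ i → 𝟙 (q i)))

  module _ {H G : Graph n} (H≃G : H ≃[ π ] G) where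

    reachable-≃ : ∀ u w → reachable H u w ≡ reachable G (s u) (s w)
    reachable-≃ u w = bool-ext
      (λ e → Walk⇒reachable (walk-map s (λ x y e′ → trans (sym (H≃G x y)) e′) (reachable⇒Walk e)))
      (λ e → Walk⇒reachable (subst₂ (Walk H) (inverseˡ π) (inverseˡ π)
        (walk-map s⁻ (λ x y e′ → trans (H≃G _ _) (trans (cong₂ G (inverseʳ π) (inverseʳ π)) e′))
          (reachable⇒Walk e))))

    removeEdge-≃ : ∀ a b → removeEdge H a b ≃[ π ] removeEdge G (s a) (s b)
    removeEdge-≃ a b u v
      rewrite ==-permute u a | ==-permute v b | ==-permute u b | ==-permute v a =
      cong (_∧ _) (H≃G u v)

    conjugate-automorphism : (τ : Fin n → Fin n) → (∀ u v → G (τ u) (τ v) ≡ G u v) →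
      ∀ u v → H (s⁻ (τ (s u))) (s⁻ (τ (s v))) ≡ H u v
    conjugate-automorphism τ τ-aut u v =
      trans (H≃G _ _) (trans (cong₂ G (inverseʳ π) (inverseʳ π)) (trans (τ-aut _ _) (sym (H≃G u v))))

==∧==-false : ∀ {n} {x a y b : Fin n} → ¬ (x ≡ a × y ≡ b) → (x == a) ∧ (y == b) ≡ false
==∧==-false {x = x} {a} {y} {b} ne with x == a in xa | y == b in yb
... | true | true = ⊥-elim (ne (==⇒≡ xa , ==⇒≡ yb))
... | true | false = refl
... | false | _ = refl

==∧==-false⇒ : ∀ {n} {x a y b : Fin n} → (x == a) ∧ (y == b) ≡ false → ¬ (x ≡ a × y ≡ b)
==∧==-false⇒ {x = x} {y = y} e (refl , refl)
  rewrite ==-refl x | ==-refl y = true≢false e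

removeEdge-true⇒ : ∀ {n} (F : Graph n) a b u v → removeEdge F a b u v ≡ true →
  (F u v ≡ true) × ¬ (u ≡ a × v ≡ b) × ¬ (u ≡ b × v ≡ a)
removeEdge-true⇒ F a b u v e with ∧-true⇒ {F u v} e
... | Fuv , not-incident with not-injective {y = false} not-incident
... | incident≡false =
  Fuv , ==∧==-false⇒ (∨-conicalˡ _ _ incident≡false) , ==∧==-false⇒ (∨-conicalʳ _ _ incident≡false)

removeEdge-intro : ∀ {n} (F : Graph n) a b u v → F u v ≡ true →
  ¬ (u ≡ a × v ≡ b) → ¬ (u ≡ b × v ≡ a) → removeEdge F a b u v ≡ true
removeEdge-intro F a b u v e n₁ n₂ =
  cong₂ _∧_ e (cong not (cong₂ _∨_ (==∧==-false n₁) (==∧==-false n₂)))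

removeEdge⊆ : ∀ {n} (F : Graph n) a b u v → removeEdge F a b u v ≡ true → F u v ≡ true
removeEdge⊆ F a b u v e = proj₁ (removeEdge-true⇒ F a b u v e)

-- Parity of the number of edges reversed by an involution

_≺_ : ∀ {n} → Fin n → Fin n → Bool
u ≺ v = toℕ u <ᵇ toℕ v

≺-asym : ∀ {n} (u v : Fin n) → u ≺ v ≡ true → v ≺ u ≡ true → ⊥
≺-asym u v e₁ e₂ =
  <-asym (<ᵇ⇒< (toℕ u) (toℕ v) (Equivalence.from T-≡ e₁)) (<ᵇ⇒< (toℕ v) (toℕ u) (Equivalence.from T-≡ e₂))

<⇒≺ : ∀ {n} {u v : Fin n} → toℕ u < toℕ v → u ≺ v ≡ true
<⇒≺ h = Equivalence.to T-≡ (<⇒<ᵇ h)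

∑² : ∀ {n} → (Fin n → Fin n → ℕ) → ℕ
∑² g = sum (λ u → sum (g u))

∑²-cong : ∀ {n} {f g : Fin n → Fin n → ℕ} → (∀ u v → f u v ≡ g u v) → ∑² f ≡ ∑² g
∑²-cong h = sum-cong-≗ (λ u → sum-cong-≗ (h u))

∑²-distrib-+ : ∀ {n} (f g : Fin n → Fin n → ℕ) → ∑² (λ u v → f u v + g u v) ≡ ∑² f + ∑² g
∑²-distrib-+ f g =
  trans (sum-cong-≗ (λ u → ∑-distrib-+ (f u) (g u))) (∑-distrib-+ (λ u → sum (f u)) (λ u → sum (g u)))

∑²-transpose-permute : ∀ {n} (π : Permutation′ n) (g : Fin n → Fin n → ℕ) →
  ∑² g ≡ ∑² (λ u v → g (π ⟨$⟩ʳ v) (π ⟨$⟩ʳ u))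
∑²-transpose-permute π g =
  trans (sum-cong-≗ (λ u → sym (sum-permute π (g u))))
  (trans (sym (sum-permute π (λ u → sum (λ v → g u (π ⟨$⟩ʳ v)))))
         (∑-comm (λ u v → g (π ⟨$⟩ʳ u) (π ⟨$⟩ʳ v))))

count-== : ∀ {n} (c : Fin n) → count (_== c) ≡ 1
count-== {suc n} zero = cong suc (trans (count-const n false) (*-zeroʳ n))
count-== {suc n} (suc c) = count-== c

∑²-point : ∀ {n} (a b : Fin n) → ∑² (λ u v → 𝟙 ((u == a) ∧ (v == b))) ≡ 1
∑²-point {n} a b = trans (sum-cong-≗ row) (count-== a)
  where
  row : ∀ u → sum (λ v → 𝟙 ((u == a) ∧ (v == b))) ≡ 𝟙 (u == a)
  row u with u == a
  ... | true = count-== b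
  ... | false = trans (count-const n false) (*-zeroʳ n)

reversedCount≡∑² : ∀ {n} (F : Graph n) (π : Permutation′ n) →
  reversedCount F π ≡ ∑² (λ u v → 𝟙 (F u v ∧ u ≺ v ∧ (π ⟨$⟩ʳ v) ≺ (π ⟨$⟩ʳ u)))
reversedCount≡∑² {n} F π =
  trans (foldr-map _+_ (λ u → countV (row u)) 0 (allFin n))
  (trans (foldr-tabulate (λ u → u) (λ u → countV (row u)))
         (sum-cong-≗ (λ u → countV≡count (row u))))
  where
  row : Fin n → Fin n → Bool
  row u v = F u v ∧ u ≺ v ∧ (π ⟨$⟩ʳ v) ≺ (π ⟨$⟩ʳ u)

<ᵇ-trichotomy : ∀ b d → 𝟙 (b ≡ᵇ d) + 𝟙 (b <ᵇ d) + 𝟙 (d <ᵇ b) ≡ 1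
<ᵇ-trichotomy zero zero = refl
<ᵇ-trichotomy zero (suc d) = refl
<ᵇ-trichotomy (suc b) zero = refl
<ᵇ-trichotomy (suc b) (suc d) = <ᵇ-trichotomy b d

-- Exactly one of (a, b) = (c, d), (a, b) < (c, d), (c, d) < (a, b) holds lexicographically.
lex-trichotomy : ∀ a b c d →
  𝟙 ((a ≡ᵇ c) ∧ (b ≡ᵇ d)) + 𝟙 ((a <ᵇ c) ∨ ((a ≡ᵇ c) ∧ (b <ᵇ d)))
    + 𝟙 ((c <ᵇ a) ∨ ((c ≡ᵇ a) ∧ (d <ᵇ b))) ≡ 1
lex-trichotomy zero b zero d = <ᵇ-trichotomy b d
lex-trichotomy zero b (suc c) d = refl
lex-trichotomy (suc a) b zero d = refl
lex-trichotomy (suc a) b (suc c) d = lex-trichotomy a b c d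

𝟙-split : ∀ x e l g → 𝟙 e + 𝟙 l + 𝟙 g ≡ 1 → 𝟙 x ≡ 𝟙 (x ∧ e) + 𝟙 (x ∧ l) + 𝟙 (x ∧ g)
𝟙-split false e l g h = refl
𝟙-split true e l g h = sym h

UniqueFlip : ∀ {n} → Graph n → (Fin n → Fin n) → Fin n → Fin n → Set
UniqueFlip F s a b = ∀ u v → F u v ≡ true → s u ≡ v → (u ≡ a × v ≡ b) ⊎ (u ≡ b × v ≡ a)

module ReversalParity {n} (F : Graph n) (s : Fin n → Fin n) (s-inv : ∀ x → s (s x) ≡ x)
  (F-sym : ∀ u v → F u v ≡ F v u) (s-aut : ∀ u v → F (s u) (s v) ≡ F u v) where

  reversed flipped : Fin n → Fin n → Bool
  reversed u v = F u v ∧ u ≺ v ∧ s v ≺ s u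
  flipped u v = F u v ∧ u ≺ v ∧ (s u == v)

  same earlier later : Fin n → Fin n → Bool
  same u v = (u == s v) ∧ (v == s u)
  earlier u v = u ≺ s v ∨ ((u == s v) ∧ v ≺ s u)
  later u v = s v ≺ u ∨ ((s v == u) ∧ s u ≺ v)

  reversed-image : ∀ u v → reversed (s v) (s u) ≡ reversed u v
  reversed-image u v rewrite s-inv u | s-inv v | s-aut v u | F-sym v u =
    ∧-rotate (F u v) {s v ≺ s u} {u ≺ v}
    where
    ∧-rotate : ∀ a {b c} → (a ∧ b ∧ c) ≡ (a ∧ c ∧ b)
    ∧-rotate false = refl
    ∧-rotate true {b} {c} = ∧-comm b c

  later-image : ∀ u v → later (s v) (s u) ≡ earlier u v
  later-image u v rewrite s-inv u | s-inv v = refl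

  reversed∧same : ∀ u v → reversed u v ∧ same u v ≡ flipped u v
  reversed∧same u v = bool-ext to from
    where
    to : reversed u v ∧ same u v ≡ true → flipped u v ≡ true
    to e with ∧-true⇒ {reversed u v} e
    ... | rev , sm with ∧-true⇒ {F u v} rev | ∧-true⇒ {u == s v} sm
    ... | Fuv , ord | _ , v=su =
      cong₂ _∧_ Fuv (cong₂ _∧_ (proj₁ (∧-true⇒ {u ≺ v} ord)) (≡⇒== {a = s u} (sym (==⇒≡ {a = v} v=su))))
    from : flipped u v ≡ true → reversed u v ∧ same u v ≡ true
    from e with ∧-true⇒ {F u v} e
    ... | Fuv , ord with ∧-true⇒ {u ≺ v} ord
    ... | u≺v , su=v =
      cong₂ _∧_ (cong₂ _∧_ Fuv (cong₂ _∧_ u≺v sv≺su)) (cong₂ _∧_ (≡⇒== (sym sv≡u)) (≡⇒== (sym su≡v)))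
      where
      su≡v : s u ≡ v
      su≡v = ==⇒≡ su=v
      sv≡u : s v ≡ u
      sv≡u = trans (cong s (sym su≡v)) (s-inv u)
      sv≺su : s v ≺ s u ≡ true
      sv≺su = subst₂ (λ x y → x ≺ y ≡ true) (sym sv≡u) (sym su≡v) u≺v

  trichotomous : ∀ u v → 𝟙 (same u v) + 𝟙 (earlier u v) + 𝟙 (later u v) ≡ 1
  trichotomous u v = lex-trichotomy (toℕ u) (toℕ v) (toℕ (s v)) (toℕ (s u))

  #reversed #flipped #earlier : ℕ
  #reversed = ∑² (λ u v → 𝟙 (reversed u v))
  #flipped = ∑² (λ u v → 𝟙 (flipped u v))
  #earlier = ∑² (λ u v → 𝟙 (reversed u v ∧ earlier u v))

  -- (u, v) ↦ (s v, s u) is an involution on reversed pairs; its fixed points are the flipped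
  -- edges, and it exchanges the earlier and the later ones.
  #reversed≡ : #reversed ≡ #flipped + (#earlier + #earlier)
  #reversed≡ = begin
    #reversed
      ≡⟨ ∑²-cong (λ u v → 𝟙-split (reversed u v) (same u v) (earlier u v) (later u v) (trichotomous u v)) ⟩
    ∑² (λ u v → 𝟙 (reversed u v ∧ same u v) + 𝟙 (reversed u v ∧ earlier u v) + 𝟙 (reversed u v ∧ later u v))
      ≡⟨ ∑²-distrib-+ _ (λ u v → 𝟙 (reversed u v ∧ later u v)) ⟩
    ∑² (λ u v → 𝟙 (reversed u v ∧ same u v) + 𝟙 (reversed u v ∧ earlier u v)) + #later
      ≡⟨ cong (_+ #later) (∑²-distrib-+ (λ u v → 𝟙 (reversed u v ∧ same u v)) _) ⟩
    ∑² (λ u v → 𝟙 (reversed u v ∧ same u v)) + #earlier + #later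
      ≡⟨ cong₂ (λ x y → x + #earlier + y) (∑²-cong (λ u v → cong 𝟙 (reversed∧same u v))) #later≡#earlier ⟩
    #flipped + #earlier + #earlier
      ≡⟨ +-assoc #flipped #earlier #earlier ⟩
    #flipped + (#earlier + #earlier) ∎
    where
    open ≡-Reasoning
    #later = ∑² (λ u v → 𝟙 (reversed u v ∧ later u v))
    #later≡#earlier : #later ≡ #earlier
    #later≡#earlier =
      trans (∑²-transpose-permute (involution s s-inv) (λ u v → 𝟙 (reversed u v ∧ later u v)))
      (∑²-cong (λ u v → cong₂ (λ x y → 𝟙 (x ∧ y)) (reversed-image u v) (later-image u v)))

  odd-if-one-flipped : #flipped ≡ 1 → reversedCount F (involution s s-inv) % 2 ≡ 1
  odd-if-one-flipped one = trans (cong (_% 2) count≡) ([m+kn]%n≡m%n 1 #earlier 2)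
    where
    count≡ : reversedCount F (involution s s-inv) ≡ 1 + #earlier * 2
    count≡ = trans (reversedCount≡∑² F (involution s s-inv))
      (trans #reversed≡ (cong₂ _+_ one
        (trans (cong (#earlier +_) (sym (+-identityʳ #earlier))) (*-comm 2 #earlier))))

  private
    one-flipped-≺ : ∀ a b → F a b ≡ true → s a ≡ b → a ≺ b ≡ true → UniqueFlip F s a b → #flipped ≡ 1
    one-flipped-≺ a b Fab sab a≺b unique = trans (∑²-cong (λ u v → cong 𝟙 (flipped≡ u v))) (∑²-point a b)
      where
      flipped≡ : ∀ u v → flipped u v ≡ (u == a) ∧ (v == b)
      flipped≡ u v = bool-ext to from
        where
        to : flipped u v ≡ true → (u == a) ∧ (v == b) ≡ true
        to e with ∧-true⇒ {F u v} e
        ... | Fuv , ord with ∧-true⇒ {u ≺ v} ord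
        ... | u≺v , su=v with unique u v Fuv (==⇒≡ su=v)
        ... | inj₁ (refl , refl) = cong₂ _∧_ (==-refl u) (==-refl v)
        ... | inj₂ (refl , refl) = ⊥-elim (≺-asym a b a≺b u≺v)
        from : (u == a) ∧ (v == b) ≡ true → flipped u v ≡ true
        from e with ∧-true⇒ {u == a} e
        ... | u=a , v=b with ==⇒≡ {a = u} u=a | ==⇒≡ {a = v} v=b
        ... | refl | refl rewrite Fab | a≺b | sab = ==-refl b

  one-flipped : ∀ a b → F a b ≡ true → s a ≡ b → a ≢ b → UniqueFlip F s a b → #flipped ≡ 1
  one-flipped a b Fab sab a≢b unique with <-cmp (toℕ a) (toℕ b)
  ... | tri< a<b _ _ = one-flipped-≺ a b Fab sab (<⇒≺ a<b) unique
  ... | tri≈ _ a≡b _ = ⊥-elim (a≢b (toℕ-injective a≡b))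
  ... | tri> _ _ b<a = one-flipped-≺ b a (trans (F-sym b a) Fab) (trans (cong s (sym sab)) (s-inv a))
                         (<⇒≺ b<a) (λ u v Fuv suv → Data.Sum.swap (unique u v Fuv suv))

Valuation₂ : ℕ → ℕ → Set
Valuation₂ e x = ∃ λ q → x ≡ 2 ^ e + q * 2 ^ suc e

Valuation₂-2^ : ∀ e → Valuation₂ e (2 ^ e)
Valuation₂-2^ e = 0 , sym (+-identityʳ (2 ^ e))

2^-mono-∣ : ∀ {a b} → a ≤ b → 2 ^ a ∣ 2 ^ b
2^-mono-∣ {a} {b} a≤b = divides (2 ^ (b ∸ a)) (begin
  2 ^ b               ≡⟨ cong (2 ^_) (sym (m+[n∸m]≡n a≤b)) ⟩
  2 ^ (a + (b ∸ a))   ≡⟨ ^-distribˡ-+-* 2 a (b ∸ a) ⟩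
  2 ^ a * 2 ^ (b ∸ a) ≡⟨ *-comm (2 ^ a) _ ⟩
  2 ^ (b ∸ a) * 2 ^ a ∎)
  where open ≡-Reasoning

Valuation₂⇒∣ : ∀ {e x} → Valuation₂ e x → 2 ^ e ∣ x
Valuation₂⇒∣ {e} (q , refl) = ∣m∣n⇒∣m+n ∣-refl (∣n⇒∣m*n q (n∣m*n 2))

Valuation₂⇒∤ : ∀ {e x} → Valuation₂ e x → ¬ (2 ^ suc e ∣ x)
Valuation₂⇒∤ {e} (q , refl) 2^1+e∣x =
  >⇒∤ {{>-nonZero (m^n>0 2 e)}} (^-monoʳ-< 2 (s≤s (s≤s z≤n)) (n<1+n e))
      (∣m+n∣m⇒∣n (subst (2 ^ suc e ∣_) (+-comm (2 ^ e) _) 2^1+e∣x) (n∣m*n q))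

Valuation₂-unique : ∀ {e e′ x} → Valuation₂ e x → Valuation₂ e′ x → e ≡ e′
Valuation₂-unique {e} {e′} v v′ with <-cmp e e′
... | tri< e<e′ _ _ = ⊥-elim (Valuation₂⇒∤ {e} v (∣-trans (2^-mono-∣ e<e′) (Valuation₂⇒∣ {e′} v′)))
... | tri≈ _ e≡e′ _ = e≡e′
... | tri> _ _ e′<e = ⊥-elim (Valuation₂⇒∤ {e′} v′ (∣-trans (2^-mono-∣ e′<e) (Valuation₂⇒∣ {e} v)))

2^-injective : ∀ {a b} → 2 ^ a ≡ 2 ^ b → a ≡ b
2^-injective {a} {b} e = Valuation₂-unique (Valuation₂-2^ a) (subst (Valuation₂ b) (sym e) (Valuation₂-2^ b))

Valuation₂-+ : ∀ {e x} k c → e < k → Valuation₂ e x → Valuation₂ e (x + 2 ^ k * c)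
Valuation₂-+ {e} k c e<k (q , refl) = q + c * 2 ^ (k ∸ suc e) , (begin
  2 ^ e + q * 2 ^ suc e + 2 ^ k * c
    ≡⟨ cong (λ z → 2 ^ e + q * 2 ^ suc e + z * c) (trans (cong (2 ^_) (sym (m+[n∸m]≡n e<k)))
         (^-distribˡ-+-* 2 (suc e) (k ∸ suc e))) ⟩
  2 ^ e + q * 2 ^ suc e + 2 ^ suc e * 2 ^ (k ∸ suc e) * c
    ≡⟨ solve 5 (λ a q c P t → a :+ q :* P :+ P :* t :* c := a :+ (q :+ c :* t) :* P) refl
         (2 ^ e) q c (2 ^ suc e) (2 ^ (k ∸ suc e)) ⟩
  2 ^ e + (q + c * 2 ^ (k ∸ suc e)) * 2 ^ suc e ∎)
  where
  open ≡-Reasoning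
  open +-*-Solver

half-2^ : ∀ {d x} → x + x ≡ 2 ^ suc d → x ≡ 2 ^ d
half-2^ {d} {x} e = *-cancelˡ-≡ x (2 ^ d) 2 (trans (cong (x +_) (+-identityʳ x)) e)

branch : ∀ {n} → Graph n → Fin n → Fin n → Fin n → Bool
branch F a b = reachable (removeEdge F a b) b

record MirrorInvolution {n} (F : Graph n) (a b : Fin n) : Set where
  constructor mirrorInvolution
  field
    τ : Fin n → Fin n
    involutive : ∀ x → τ (τ x) ≡ x
    automorphism : ∀ u v → F (τ u) (τ v) ≡ F u v
    fixes-others : ∀ w → reachable F a w ≡ false → τ w ≡ w
    swaps : τ a ≡ b
    unique-flip : UniqueFlip F τ a b

record BranchSizes {n} (F : Graph n) (a b : Fin n) (ℓ k j : ℕ) : Set where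
  constructor branchSizes
  field
    valuation : Valuation₂ (k ∸ ℓ) (count (branch F a b))
    component : count (branch F b a) + count (branch F a b) ≡ 2 ^ (k ∸ j)

module _ {n} (π : Permutation′ n) {H G : Graph n} (H≃G : H ≃[ π ] G) where
  private
    s = π ⟨$⟩ʳ_
    s⁻ = π ⟨$⟩ˡ_

  branch-≃ : ∀ a b x → branch H a b x ≡ branch G (s a) (s b) (s x)
  branch-≃ a b x = reachable-≃ π (removeEdge-≃ π {G = G} H≃G a b) b x

  branches-complementary-≃ : ∀ a b → (∀ x → branch G (s b) (s a) x ≡ not (branch G (s a) (s b) x)) →
    ∀ x → branch H b a x ≡ not (branch H a b x)
  branches-complementary-≃ a b h x =
    trans (branch-≃ b a x) (trans (h (s x)) (cong not (sym (branch-≃ a b x))))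

  BranchSizes-≃ : ∀ {a b ℓ k j} → BranchSizes G (s a) (s b) ℓ k j → BranchSizes H a b ℓ k j
  BranchSizes-≃ {a} {b} (branchSizes (q , val) comp) =
    branchSizes (q , trans (#branch a b) val) (trans (cong₂ _+_ (#branch b a) (#branch a b)) comp)
    where
    #branch : ∀ a b → count (branch H a b) ≡ count (branch G (s a) (s b))
    #branch a b = count-permute π _ _ (branch-≃ a b)

  MirrorInvolution-≃ : ∀ {a b} → MirrorInvolution G (s a) (s b) → MirrorInvolution H a b
  MirrorInvolution-≃ {a} {b} (mirrorInvolution τ inv aut fix swaps unique) = mirrorInvolution
    τ′ inv′ (conjugate-automorphism π H≃G τ aut) fix′ (trans (cong s⁻ swaps) (inverseˡ π)) unique′
    where
    τ′ : Fin n → Fin n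
    τ′ x = s⁻ (τ (s x))
    inv′ : ∀ x → τ′ (τ′ x) ≡ x
    inv′ x = trans (cong (λ z → s⁻ (τ z)) (inverseʳ π)) (trans (cong s⁻ (inv (s x))) (inverseˡ π))
    fix′ : ∀ w → reachable H a w ≡ false → τ′ w ≡ w
    fix′ w e = trans (cong s⁻ (fix (s w) (trans (sym (reachable-≃ π H≃G a w)) e))) (inverseˡ π)
    unique′ : UniqueFlip H τ′ a b
    unique′ u v Huv τ′u≡v with unique (s u) (s v) (trans (sym (H≃G u v)) Huv)
                                (trans (sym (inverseʳ π)) (cong s τ′u≡v))
    ... | inj₁ (p , q) = inj₁ (⟨$⟩ʳ-injective π p , ⟨$⟩ʳ-injective π q)
    ... | inj₂ (p , q) = inj₂ (⟨$⟩ʳ-injective π p , ⟨$⟩ʳ-injective π q)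

Cut : ∀ {n} → Graph n → (Fin n → Fin n → ℕ) → ℕ → Graph n
Cut T level j u v = T u v ∧ (j <ᵇ level u v)

Cut⊆ : ∀ {n} (T : Graph n) level j u v → Cut T level j u v ≡ true → T u v ≡ true
Cut⊆ T level j u v e = proj₁ (∧-true⇒ {T u v} e)

Cut⇒< : ∀ {n} (T : Graph n) level j u v → Cut T level j u v ≡ true → j < level u v
Cut⇒< T level j u v e = <ᵇ⇒< j (level u v) (Equivalence.from T-≡ (proj₂ (∧-true⇒ {T u v} e)))

<⇒Cut : ∀ {n} (T : Graph n) level j u v → T u v ≡ true → j < level u v → Cut T level j u v ≡ true
<⇒Cut T level j u v e j<ℓ = cong₂ _∧_ e (Equivalence.to T-≡ (<⇒<ᵇ j<ℓ))

Cut-zero : ∀ {n} (T : Graph n) level → (∀ u v → T u v ≡ true → 1 ≤ level u v) →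
  ∀ u v → Cut T level 0 u v ≡ T u v
Cut-zero T level level≥1 u v =
  bool-ext (Cut⊆ T level 0 u v) (λ e → <⇒Cut T level 0 u v e (level≥1 u v e))

Cut-sym : ∀ {n} (T : Graph n) level → (∀ u v → T u v ≡ T v u) → (∀ u v → level u v ≡ level v u) →
  ∀ j u v → Cut T level j u v ≡ Cut T level j v u
Cut-sym T level T-sym level-sym j u v = cong₂ _∧_ (T-sym u v) (cong (j <ᵇ_) (level-sym u v))

-- level u v counts the doubling steps, from the last one backwards, up to the one that
-- created the edge uv; Cut T level j is thus the forest left after j cutting steps.
record LevelledTree {n} (T : Graph n) (k : ℕ) : Set where
  field
    size : n ≡ 2 ^ k
    level : Fin n → Fin n → ℕ
    symmetric : ∀ u v → T u v ≡ T v u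
    irreflexive : ∀ u → T u u ≡ false
    level-sym : ∀ u v → level u v ≡ level v u
    level≥1 : ∀ u v → T u v ≡ true → 1 ≤ level u v
    level≤k : ∀ u v → T u v ≡ true → level u v ≤ k
    connected : ∀ u v → reachable T u v ≡ true
    branches-complementary : ∀ a b → T a b ≡ true → ∀ x → branch T b a x ≡ not (branch T a b x)
    mirror : ∀ j a b → Cut T level j a b ≡ true → level a b ≡ suc j → MirrorInvolution (Cut T level j) a b
    branch-sizes : ∀ j a b → Cut T level j a b ≡ true → BranchSizes (Cut T level j) a b (level a b) k j

LevelledTree-≃ : ∀ {n} {G H : Graph n} {k} (π : Permutation′ n) → H ≃[ π ] G →
  LevelledTree G k → LevelledTree H k
LevelledTree-≃ {n} {G} {H} {k} π H≃G L = record
  { size = size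
  ; level = level′
  ; symmetric = λ u v → trans (H≃G u v) (trans (symmetric _ _) (sym (H≃G v u)))
  ; irreflexive = λ u → trans (H≃G u u) (irreflexive _)
  ; level-sym = λ u v → level-sym _ _
  ; level≥1 = λ u v e → level≥1 _ _ (trans (sym (H≃G u v)) e)
  ; level≤k = λ u v e → level≤k _ _ (trans (sym (H≃G u v)) e)
  ; connected = λ u v → trans (reachable-≃ π H≃G u v) (connected _ _)
  ; branches-complementary = λ a b e →
      branches-complementary-≃ π H≃G a b (branches-complementary _ _ (trans (sym (H≃G a b)) e))
  ; mirror = λ j a b e l → MirrorInvolution-≃ π (Cut≃ j) (mirror j _ _ (trans (sym (Cut≃ j a b)) e) l)
  ; branch-sizes = λ j a b e → BranchSizes-≃ π (Cut≃ j) (branch-sizes j _ _ (trans (sym (Cut≃ j a b)) e))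
  }
  where
  open LevelledTree L
  level′ : Fin n → Fin n → ℕ
  level′ u v = level (π ⟨$⟩ʳ u) (π ⟨$⟩ʳ v)
  Cut≃ : ∀ j → Cut H level′ j ≃[ π ] Cut G level j
  Cut≃ j u v = cong (_∧ _) (H≃G u v)

LevelledTree-one : (G : Graph 1) → (∀ u v → G u v ≡ false) → LevelledTree G 0
LevelledTree-one G edgeless = record
  { size = refl
  ; level = λ _ _ → 0
  ; symmetric = λ u v → trans (edgeless u v) (sym (edgeless v u))
  ; irreflexive = λ u → edgeless u u
  ; level-sym = λ _ _ → refl
  ; level≥1 = λ u v e → ⊥-elim (no-edge u v e)
  ; level≤k = λ u v e → ⊥-elim (no-edge u v e)
  ; connected = λ { zero zero → Walk⇒reachable {u = zero} (nil {F = G}) }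
  ; branches-complementary = λ a b e → ⊥-elim (no-edge a b e)
  ; mirror = λ j a b e _ → ⊥-elim (no-edge a b (Cut⊆ G (λ _ _ → 0) j a b e))
  ; branch-sizes = λ j a b e → ⊥-elim (no-edge a b (Cut⊆ G (λ _ _ → 0) j a b e))
  }
  where
  no-edge : ∀ u v → G u v ≢ true
  no-edge u v e = true≢false (trans (sym e) (edgeless u v))

-- Doubling

module Doubling {m} (G : Graph m) (r : Fin m) {k} (L : LevelledTree G k) where
  open LevelledTree L

  T′ : Graph (m + m)
  T′ = double G r

  inl inr : Fin m → Fin (m + m)
  inl x = x ↑ˡ m
  inr x = m ↑ʳ x

  data Copy : Fin (m + m) → Set where
    in-left  : ∀ x → Copy (inl x)
    in-right : ∀ x → Copy (inr x)

  copy : ∀ u → Copy u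
  copy u with splitAt m u in e
  ... | inj₁ x = subst Copy (splitAt⁻¹-↑ˡ e) (in-left x)
  ... | inj₂ x = subst Copy (splitAt⁻¹-↑ʳ e) (in-right x)

  splitAt-inl : ∀ x → splitAt m (inl x) ≡ inj₁ x
  splitAt-inl x = splitAt-↑ˡ m x m

  splitAt-inr : ∀ x → splitAt m (inr x) ≡ inj₂ x
  splitAt-inr x = splitAt-↑ʳ m m x

  inl≢inr : ∀ {x y} → inl x ≢ inr y
  inl≢inr {x} {y} e with trans (sym (splitAt-inl x)) (trans (cong (splitAt m) e) (splitAt-inr y))
  ... | ()

  inl-injective : ∀ {x y} → inl x ≡ inl y → x ≡ y
  inl-injective = ↑ˡ-injective m _ _

  inr-injective : ∀ {x y} → inr x ≡ inr y → x ≡ y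
  inr-injective = ↑ʳ-injective m _ _

  T′-ll : ∀ x y → T′ (inl x) (inl y) ≡ G x y
  T′-ll x y rewrite splitAt-inl x | splitAt-inl y = refl

  T′-rr : ∀ x y → T′ (inr x) (inr y) ≡ G x y
  T′-rr x y rewrite splitAt-inr x | splitAt-inr y = refl

  T′-lr : ∀ x y → T′ (inl x) (inr y) ≡ (x == r) ∧ (y == r)
  T′-lr x y rewrite splitAt-inl x | splitAt-inr y = refl

  T′-rl : ∀ x y → T′ (inr x) (inl y) ≡ (x == r) ∧ (y == r)
  T′-rl x y rewrite splitAt-inr x | splitAt-inl y = refl

  cross-lr : ∀ {x y} → T′ (inl x) (inr y) ≡ true → x ≡ r × y ≡ r
  cross-lr {x} {y} e with ∧-true⇒ {x == r} (trans (sym (T′-lr x y)) e)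
  ... | x=r , y=r = ==⇒≡ x=r , ==⇒≡ y=r

  cross-rl : ∀ {x y} → T′ (inr x) (inl y) ≡ true → x ≡ r × y ≡ r
  cross-rl {x} {y} e with ∧-true⇒ {x == r} (trans (sym (T′-rl x y)) e)
  ... | x=r , y=r = ==⇒≡ x=r , ==⇒≡ y=r

  bridge-lr : T′ (inl r) (inr r) ≡ true
  bridge-lr = trans (T′-lr r r) (cong₂ _∧_ (==-refl r) (==-refl r))

  bridge-rl : T′ (inr r) (inl r) ≡ true
  bridge-rl = trans (T′-rl r r) (cong₂ _∧_ (==-refl r) (==-refl r))

  level′ : Fin (m + m) → Fin (m + m) → ℕ
  level′ u v = level-of (splitAt m u) (splitAt m v)
    where
    level-of : Fin m ⊎ Fin m → Fin m ⊎ Fin m → ℕ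
    level-of (inj₁ x) (inj₁ y) = suc (level x y)
    level-of (inj₂ x) (inj₂ y) = suc (level x y)
    level-of (inj₁ _) (inj₂ _) = 1
    level-of (inj₂ _) (inj₁ _) = 1

  level′-ll : ∀ x y → level′ (inl x) (inl y) ≡ suc (level x y)
  level′-ll x y rewrite splitAt-inl x | splitAt-inl y = refl

  level′-rr : ∀ x y → level′ (inr x) (inr y) ≡ suc (level x y)
  level′-rr x y rewrite splitAt-inr x | splitAt-inr y = refl

  level′-lr : ∀ x y → level′ (inl x) (inr y) ≡ 1
  level′-lr x y rewrite splitAt-inl x | splitAt-inr y = refl

  level′-rl : ∀ x y → level′ (inr x) (inl y) ≡ 1
  level′-rl x y rewrite splitAt-inr x | splitAt-inl y = refl

  exchange : Fin (m + m) → Fin (m + m)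
  exchange u = join m m (Data.Sum.swap (splitAt m u))

  exchange-inl : ∀ x → exchange (inl x) ≡ inr x
  exchange-inl x rewrite splitAt-inl x = refl

  exchange-inr : ∀ x → exchange (inr x) ≡ inl x
  exchange-inr x rewrite splitAt-inr x = refl

  exchange-involutive : ∀ u → exchange (exchange u) ≡ u
  exchange-involutive u with copy u
  ... | in-left x rewrite exchange-inl x = exchange-inr x
  ... | in-right x rewrite exchange-inr x = exchange-inl x

  exchangeₚ : Permutation′ (m + m)
  exchangeₚ = involution exchange exchange-involutive

  exchange-automorphism : ∀ u v → T′ (exchange u) (exchange v) ≡ T′ u v
  exchange-automorphism u v with copy u | copy v
  ... | in-left x | in-left y rewrite exchange-inl x | exchange-inl y | T′-ll x y | T′-rr x y = refl
  ... | in-right x | in-right y rewrite exchange-inr x | exchange-inr y | T′-ll x y | T′-rr x y = refl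
  ... | in-left x | in-right y rewrite exchange-inl x | exchange-inr y | T′-lr x y | T′-rl x y = refl
  ... | in-right x | in-left y rewrite exchange-inr x | exchange-inl y | T′-lr x y | T′-rl x y = refl

  exchange-level : ∀ u v → level′ (exchange u) (exchange v) ≡ level′ u v
  exchange-level u v with copy u | copy v
  ... | in-left x | in-left y rewrite exchange-inl x | exchange-inl y | level′-ll x y | level′-rr x y = refl
  ... | in-right x | in-right y rewrite exchange-inr x | exchange-inr y | level′-ll x y | level′-rr x y = refl
  ... | in-left x | in-right y rewrite exchange-inl x | exchange-inr y | level′-lr x y | level′-rl x y = refl
  ... | in-right x | in-left y rewrite exchange-inr x | exchange-inl y | level′-lr x y | level′-rl x y = refl

  T′-exchange : T′ ≃[ exchangeₚ ] T′
  T′-exchange u v = sym (exchange-automorphism u v)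

  T′-symmetric : ∀ u v → T′ u v ≡ T′ v u
  T′-symmetric u v with copy u | copy v
  ... | in-left x | in-left y rewrite T′-ll x y | T′-ll y x = symmetric x y
  ... | in-right x | in-right y rewrite T′-rr x y | T′-rr y x = symmetric x y
  ... | in-left x | in-right y rewrite T′-lr x y | T′-rl y x = ∧-comm (x == r) (y == r)
  ... | in-right x | in-left y rewrite T′-rl x y | T′-lr y x = ∧-comm (x == r) (y == r)

  T′-irreflexive : ∀ u → T′ u u ≡ false
  T′-irreflexive u with copy u
  ... | in-left x rewrite T′-ll x x = irreflexive x
  ... | in-right x rewrite T′-rr x x = irreflexive x

  level′-sym : ∀ u v → level′ u v ≡ level′ v u
  level′-sym u v with copy u | copy v
  ... | in-left x | in-left y rewrite level′-ll x y | level′-ll y x = cong suc (level-sym x y)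
  ... | in-right x | in-right y rewrite level′-rr x y | level′-rr y x = cong suc (level-sym x y)
  ... | in-left x | in-right y rewrite level′-lr x y | level′-rl y x = refl
  ... | in-right x | in-left y rewrite level′-rl x y | level′-lr y x = refl

  level′≥1 : ∀ u v → T′ u v ≡ true → 1 ≤ level′ u v
  level′≥1 u v _ with copy u | copy v
  ... | in-left x | in-left y rewrite level′-ll x y = s≤s z≤n
  ... | in-right x | in-right y rewrite level′-rr x y = s≤s z≤n
  ... | in-left x | in-right y rewrite level′-lr x y = s≤s z≤n
  ... | in-right x | in-left y rewrite level′-rl x y = s≤s z≤n

  level′≤ : ∀ u v → T′ u v ≡ true → level′ u v ≤ suc k
  level′≤ u v e with copy u | copy v
  ... | in-left x | in-left y rewrite level′-ll x y = s≤s (level≤k x y (trans (sym (T′-ll x y)) e))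
  ... | in-right x | in-right y rewrite level′-rr x y = s≤s (level≤k x y (trans (sym (T′-rr x y)) e))
  ... | in-left x | in-right y rewrite level′-lr x y = s≤s z≤n
  ... | in-right x | in-left y rewrite level′-rl x y = s≤s z≤n

  by-symmetry : {P : Fin (m + m) → Fin (m + m) → Set} → (∀ a b → P (exchange a) (exchange b) → P a b) →
    (∀ x b → P (inl x) b) → ∀ a b → P a b
  by-symmetry {P} transport left a b with copy a
  ... | in-left x = left x b
  ... | in-right x = transport (inr x) b
          (subst (λ a′ → P a′ (exchange b)) (sym (exchange-inr x)) (left x (exchange b)))

  walk-inl : ∀ {x y} → Walk G x y → Walk T′ (inl x) (inl y)
  walk-inl = walk-map inl (λ a b e → trans (T′-ll a b) e)

  walk-inr : ∀ {x y} → Walk G x y → Walk T′ (inr x) (inr y)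
  walk-inr = walk-map inr (λ a b e → trans (T′-rr a b) e)

  walk-to-root : ∀ u → Walk T′ u (inl r)
  walk-to-root u with copy u
  ... | in-left x = walk-inl (reachable⇒Walk (connected x r))
  ... | in-right x = snoc (walk-inr (reachable⇒Walk (connected x r))) bridge-rl

  T′-connected : ∀ u v → reachable T′ u v ≡ true
  T′-connected u v = Walk⇒reachable (walk-++ (walk-to-root u) (walk-reverse T′-symmetric (walk-to-root v)))

  Cut′ : ℕ → Graph (m + m)
  Cut′ = Cut T′ level′

  Cut′-zero : ∀ u v → Cut′ 0 u v ≡ T′ u v
  Cut′-zero = Cut-zero T′ level′ level′≥1

  Cut′-exchange : ∀ j → Cut′ j ≃[ exchangeₚ ] Cut′ j
  Cut′-exchange j u v = sym (cong₂ _∧_ (exchange-automorphism u v) (cong (j <ᵇ_) (exchange-level u v)))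

  Cut′-ll : ∀ j x y → Cut′ (suc j) (inl x) (inl y) ≡ Cut G level j x y
  Cut′-ll j x y rewrite T′-ll x y | level′-ll x y = refl

  Cut′-lr : ∀ j x y → Cut′ (suc j) (inl x) (inr y) ≡ false
  Cut′-lr j x y rewrite T′-lr x y | level′-lr x y = ∧-zeroʳ _

  Cut′-rl : ∀ j x y → Cut′ (suc j) (inr x) (inl y) ≡ false
  Cut′-rl j x y rewrite T′-rl x y | level′-rl x y = ∧-zeroʳ _

  ==-inl : ∀ x y → (inl x == inl y) ≡ (x == y)
  ==-inl = ==-injective inl inl-injective

  removeEdge-inl : (F : Graph m) (F′ : Graph (m + m)) → (∀ a b → F′ (inl a) (inl b) ≡ F a b) →
    ∀ x y a b → removeEdge F′ (inl x) (inl y) (inl a) (inl b) ≡ removeEdge F x y a b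
  removeEdge-inl F F′ h x y a b rewrite ==-inl a x | ==-inl b y | ==-inl a y | ==-inl b x =
    cong (_∧ _) (h a b)

  removeEdge-inr : ∀ x b a c → G a c ≡ true → removeEdge T′ (inl x) b (inr a) (inr c) ≡ true
  removeEdge-inr x b a c e = removeEdge-intro T′ (inl x) b (inr a) (inr c) (trans (T′-rr a c) e)
    (λ { (p , _) → inl≢inr (sym p) }) (λ { (_ , q) → inl≢inr (sym q) })

  -- y's side of the edge xy in the left copy, plus the whole right copy when it hangs off r.
  left-branch : Fin m → Fin m → Fin (m + m) → Bool
  left-branch x y u = [ branch G x y , (λ _ → branch G x y r) ]′ (splitAt m u)

  left-branch-inl : ∀ x y z → left-branch x y (inl z) ≡ branch G x y z
  left-branch-inl x y z rewrite splitAt-inl z = refl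

  left-branch-inr : ∀ x y z → left-branch x y (inr z) ≡ branch G x y r
  left-branch-inr x y z rewrite splitAt-inr z = refl

  branch-T′-ll : ∀ x y → G x y ≡ true → ∀ u → branch T′ (inl x) (inl y) u ≡ left-branch x y u
  branch-T′-ll x y Gxy = reachable-char T′∖xy (left-branch x y) (inl y) contains-y closed walk
    where
    T′∖xy = removeEdge T′ (inl x) (inl y)
    G∖xy = removeEdge G x y
    in-G∖xy : ∀ a b → T′∖xy (inl a) (inl b) ≡ G∖xy a b
    in-G∖xy = removeEdge-inl G T′ T′-ll x y
    contains-y : left-branch x y (inl y) ≡ true
    contains-y = trans (left-branch-inl x y y) (Walk⇒reachable {F = G∖xy} nil)
    closed : ∀ a b → left-branch x y a ≡ true → T′∖xy a b ≡ true → left-branch x y b ≡ true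
    closed a b in-a e with copy a | copy b
    ... | in-left z | in-left w = trans (left-branch-inl x y w)
          (reachable-step {F = G∖xy} (trans (sym (left-branch-inl x y z)) in-a) (trans (sym (in-G∖xy z w)) e))
    ... | in-left z | in-right w with cross-lr (removeEdge⊆ T′ _ _ _ _ e)
    ... | refl , _ = trans (left-branch-inr x y w) (trans (sym (left-branch-inl x y r)) in-a)
    closed a b in-a e | in-right z | in-left w with cross-rl (removeEdge⊆ T′ _ _ _ _ e)
    ... | _ , refl = trans (left-branch-inl x y r) (trans (sym (left-branch-inr x y z)) in-a)
    closed a b in-a e | in-right z | in-right w =
      trans (left-branch-inr x y w) (trans (sym (left-branch-inr x y z)) in-a)
    walk-left : ∀ {a b} → Walk G∖xy a b → Walk T′∖xy (inl a) (inl b)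
    walk-left = walk-map inl (λ a b e → trans (in-G∖xy a b) e)
    walk : ∀ u → left-branch x y u ≡ true → Walk T′∖xy (inl y) u
    walk u in-u with copy u
    ... | in-left z = walk-left (reachable⇒Walk {F = G∖xy} (trans (sym (left-branch-inl x y z)) in-u))
    ... | in-right z = walk-++
          (snoc (walk-left (reachable⇒Walk {F = G∖xy} (trans (sym (left-branch-inr x y z)) in-u)))
                (removeEdge-intro T′ (inl x) (inl y) (inl r) (inr r) bridge-lr
                  (λ { (_ , p) → inl≢inr (sym p) }) (λ { (_ , p) → inl≢inr (sym p) })))
          (walk-map inr (removeEdge-inr x (inl y)) (reachable⇒Walk (connected r z)))

  in-right-copy : Fin (m + m) → Bool
  in-right-copy u = [ (λ _ → false) , (λ _ → true) ]′ (splitAt m u)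

  in-right-copy-inl : ∀ z → in-right-copy (inl z) ≡ false
  in-right-copy-inl z rewrite splitAt-inl z = refl

  in-right-copy-inr : ∀ z → in-right-copy (inr z) ≡ true
  in-right-copy-inr z rewrite splitAt-inr z = refl

  branch-bridge : ∀ u → branch T′ (inl r) (inr r) u ≡ in-right-copy u
  branch-bridge = reachable-char T′∖bridge in-right-copy (inr r) (in-right-copy-inr r) closed walk
    where
    T′∖bridge = removeEdge T′ (inl r) (inr r)
    closed : ∀ a b → in-right-copy a ≡ true → T′∖bridge a b ≡ true → in-right-copy b ≡ true
    closed a b in-a e with copy a | copy b
    ... | in-left z | _ = ⊥-elim (true≢false (trans (sym in-a) (in-right-copy-inl z)))
    ... | in-right z | in-right w = in-right-copy-inr w
    ... | in-right z | in-left w with cross-rl (removeEdge⊆ T′ _ _ _ _ e)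
    ... | refl , refl = ⊥-elim (not-bridge (refl , refl))
      where not-bridge = proj₂ (proj₂ (removeEdge-true⇒ T′ (inl r) (inr r) (inr r) (inl r) e))
    walk : ∀ u → in-right-copy u ≡ true → Walk T′∖bridge (inr r) u
    walk u in-u with copy u
    ... | in-left z = ⊥-elim (true≢false (trans (sym in-u) (in-right-copy-inl z)))
    ... | in-right z = walk-map inr (removeEdge-inr r (inr r)) (reachable⇒Walk (connected r z))

  in-right-copy-exchange : ∀ u → in-right-copy (exchange u) ≡ not (in-right-copy u)
  in-right-copy-exchange u with copy u
  ... | in-left z rewrite exchange-inl z | in-right-copy-inl z | in-right-copy-inr z = refl
  ... | in-right z rewrite exchange-inr z | in-right-copy-inl z | in-right-copy-inr z = refl

  branch-bridge′ : ∀ u → branch T′ (inr r) (inl r) u ≡ not (in-right-copy u)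
  branch-bridge′ u = trans (branch-≃ exchangeₚ T′-exchange (inr r) (inl r) u)
    (subst₂ (λ a b → branch T′ a b (exchange u) ≡ not (in-right-copy u))
      (sym (exchange-inr r)) (sym (exchange-inl r))
      (trans (branch-bridge (exchange u)) (in-right-copy-exchange u)))

  branches-complementary-inl : ∀ x b → T′ (inl x) b ≡ true →
    ∀ u → branch T′ b (inl x) u ≡ not (branch T′ (inl x) b u)
  branches-complementary-inl x b e u with copy b
  ... | in-left y = trans (branch-T′-ll y x Gyx u)
          (trans (complementary u) (cong not (sym (branch-T′-ll x y Gxy u))))
    where
    Gxy : G x y ≡ true
    Gxy = trans (sym (T′-ll x y)) e
    Gyx : G y x ≡ true
    Gyx = trans (symmetric y x) Gxy
    complementary : ∀ u → left-branch y x u ≡ not (left-branch x y u)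
    complementary u with copy u
    ... | in-left z rewrite left-branch-inl y x z | left-branch-inl x y z = branches-complementary x y Gxy z
    ... | in-right z rewrite left-branch-inr y x z | left-branch-inr x y z = branches-complementary x y Gxy r
  ... | in-right y with cross-lr e
  ... | refl , refl = trans (branch-bridge′ u) (cong not (sym (branch-bridge u)))

  T′-branches-complementary : ∀ a b → T′ a b ≡ true → ∀ u → branch T′ b a u ≡ not (branch T′ a b u)
  T′-branches-complementary = by-symmetry
    (λ a b h e → branches-complementary-≃ exchangeₚ T′-exchange a b (h (trans (exchange-automorphism a b) e)))
    branches-complementary-inl

  m≡2^k : m ≡ 2 ^ k
  m≡2^k = size

  m+m≡2^1+k : m + m ≡ 2 ^ suc k
  m+m≡2^1+k = cong₂ _+_ m≡2^k (trans m≡2^k (sym (+-identityʳ _)))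

  count-copies : (p : Fin (m + m) → Bool) → count p ≡ count (λ z → p (inl z)) + count (λ z → p (inr z))
  count-copies = count-↑ m

  #branch-T′-ll : ∀ x y → G x y ≡ true →
    count (branch T′ (inl x) (inl y)) ≡ count (branch G x y) + m * 𝟙 (branch G x y r)
  #branch-T′-ll x y Gxy = trans (count-cong (branch-T′-ll x y Gxy))
    (trans (count-copies (left-branch x y))
      (cong₂ _+_ (count-cong (left-branch-inl x y))
                 (trans (count-cong (left-branch-inr x y)) (count-const m _))))

  #in-right-copy : count in-right-copy ≡ m
  #in-right-copy = begin
    count in-right-copy
      ≡⟨ count-copies in-right-copy ⟩
    count (λ z → in-right-copy (inl z)) + count (λ z → in-right-copy (inr z))
      ≡⟨ cong₂ _+_ (count-cong in-right-copy-inl) (count-cong in-right-copy-inr) ⟩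
    count {m} (λ _ → false) + count {m} (λ _ → true)
      ≡⟨ cong₂ _+_ (trans (count-const m false) (*-zeroʳ m)) (trans (count-const m true) (*-identityʳ m)) ⟩
    m ∎
    where open ≡-Reasoning

  #in-left-copy : count (λ u → not (in-right-copy u)) ≡ m
  #in-left-copy = begin
    count (λ u → not (in-right-copy u))
      ≡⟨ count-copies (λ u → not (in-right-copy u)) ⟩
    count (λ z → not (in-right-copy (inl z))) + count (λ z → not (in-right-copy (inr z)))
      ≡⟨ cong₂ _+_ (count-cong (λ z → cong not (in-right-copy-inl z)))
                   (count-cong (λ z → cong not (in-right-copy-inr z))) ⟩
    count {m} (λ _ → true) + count {m} (λ _ → false)
      ≡⟨ cong₂ _+_ (trans (count-const m true) (*-identityʳ m)) (trans (count-const m false) (*-zeroʳ m)) ⟩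
    m + 0
      ≡⟨ +-identityʳ m ⟩
    m ∎
    where open ≡-Reasoning

  branch-sizes-G : ∀ x y → G x y ≡ true → BranchSizes G x y (level x y) k 0
  branch-sizes-G x y Gxy = BranchSizes-≃ idₚ (λ u v → sym (Cut-zero G level level≥1 u v))
    (branch-sizes 0 x y (<⇒Cut G level 0 x y Gxy (level≥1 x y Gxy)))

  branch-sizes-T′-ll : ∀ x y → G x y ≡ true → BranchSizes T′ (inl x) (inl y) (suc (level x y)) (suc k) 0
  branch-sizes-T′-ll x y Gxy with branch-sizes-G x y Gxy
  ... | branchSizes val comp = branchSizes
    (subst (Valuation₂ (k ∸ level x y)) (sym (trans (#branch-T′-ll x y Gxy) (cong (λ z → _ + z * _) m≡2^k)))
      (Valuation₂-+ k (𝟙 c) (∸-monoʳ-< (level≥1 x y Gxy) (level≤k x y Gxy)) val))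
    (begin
      count (branch T′ (inl y) (inl x)) + count (branch T′ (inl x) (inl y))
        ≡⟨ cong₂ _+_ (#branch-T′-ll y x (trans (symmetric y x) Gxy)) (#branch-T′-ll x y Gxy) ⟩
      (count (branch G y x) + m * 𝟙 (branch G y x r)) + (count (branch G x y) + m * 𝟙 c)
        ≡⟨ cong (λ z → (count (branch G y x) + m * 𝟙 z) + (count (branch G x y) + m * 𝟙 c))
                (branches-complementary x y Gxy r) ⟩
      (count (branch G y x) + m * 𝟙 (not c)) + (count (branch G x y) + m * 𝟙 c)
        ≡⟨ solve 4 (λ A a B b → (A :+ a) :+ (B :+ b) := (A :+ B) :+ (a :+ b)) refl
             (count (branch G y x)) (m * 𝟙 (not c)) (count (branch G x y)) (m * 𝟙 c) ⟩
      (count (branch G y x) + count (branch G x y)) + (m * 𝟙 (not c) + m * 𝟙 c)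
        ≡⟨ cong₂ _+_ comp (complement c) ⟩
      2 ^ k + m
        ≡⟨ trans (cong (_+ m) (sym m≡2^k)) m+m≡2^1+k ⟩
      2 ^ suc k ∎)
    where
    open ≡-Reasoning
    open +-*-Solver
    c = branch G x y r
    complement : ∀ c → m * 𝟙 (not c) + m * 𝟙 c ≡ m
    complement true = trans (cong (_+ m * 1) (*-zeroʳ m)) (*-identityʳ m)
    complement false = trans (cong₂ _+_ (*-identityʳ m) (*-zeroʳ m)) (+-identityʳ m)

  branch-sizes-bridge : BranchSizes T′ (inl r) (inr r) 1 (suc k) 0
  branch-sizes-bridge = branchSizes
    (subst (Valuation₂ k) (sym (trans #right m≡2^k)) (Valuation₂-2^ k))
    (trans (cong₂ _+_ (trans (count-cong branch-bridge′) #in-left-copy) #right) m+m≡2^1+k)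
    where
    #right : count (branch T′ (inl r) (inr r)) ≡ m
    #right = trans (count-cong branch-bridge) #in-right-copy

  module _ (F : Graph m) (F′ : Graph (m + m)) (F′-ll : ∀ a b → F′ (inl a) (inl b) ≡ F a b)
           (F′-lr : ∀ a b → F′ (inl a) (inr b) ≡ false) where

    left-only : Fin m → Fin m → Fin (m + m) → Bool
    left-only x y u = [ branch F x y , (λ _ → false) ]′ (splitAt m u)

    left-only-inl : ∀ x y z → left-only x y (inl z) ≡ branch F x y z
    left-only-inl x y z rewrite splitAt-inl z = refl

    left-only-inr : ∀ x y z → left-only x y (inr z) ≡ false
    left-only-inr x y z rewrite splitAt-inr z = refl

    branch-left-only : ∀ x y u → branch F′ (inl x) (inl y) u ≡ left-only x y u
    branch-left-only x y = reachable-char F′∖xy (left-only x y) (inl y) contains-y closed walk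
      where
      F′∖xy = removeEdge F′ (inl x) (inl y)
      F∖xy = removeEdge F x y
      contains-y : left-only x y (inl y) ≡ true
      contains-y = trans (left-only-inl x y y) (Walk⇒reachable {F = F∖xy} nil)
      closed : ∀ a b → left-only x y a ≡ true → F′∖xy a b ≡ true → left-only x y b ≡ true
      closed a b in-a e with copy a | copy b
      ... | in-left z | in-left w = trans (left-only-inl x y w)
            (reachable-step {F = F∖xy} (trans (sym (left-only-inl x y z)) in-a)
              (trans (sym (removeEdge-inl F F′ F′-ll x y z w)) e))
      ... | in-left z | in-right w = ⊥-elim (true≢false (trans (sym (removeEdge⊆ F′ _ _ _ _ e)) (F′-lr z w)))
      ... | in-right z | _ = ⊥-elim (true≢false (trans (sym in-a) (left-only-inr x y z)))
      walk : ∀ u → left-only x y u ≡ true → Walk F′∖xy (inl y) u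
      walk u in-u with copy u
      ... | in-left z = walk-map inl (λ a b e → trans (removeEdge-inl F F′ F′-ll x y a b) e)
              (reachable⇒Walk {F = F∖xy} (trans (sym (left-only-inl x y z)) in-u))
      ... | in-right z = ⊥-elim (true≢false (trans (sym in-u) (left-only-inr x y z)))

    #branch-left-only : ∀ x y → count (branch F′ (inl x) (inl y)) ≡ count (branch F x y)
    #branch-left-only x y = begin
      count (branch F′ (inl x) (inl y))
        ≡⟨ trans (count-cong (branch-left-only x y)) (count-copies (left-only x y)) ⟩
      count (λ z → left-only x y (inl z)) + count (λ z → left-only x y (inr z))
        ≡⟨ cong₂ _+_ (count-cong (left-only-inl x y))
                     (trans (count-cong (left-only-inr x y)) (count-const m false)) ⟩
      count (branch F x y) + m * 0
        ≡⟨ trans (cong (count (branch F x y) +_) (*-zeroʳ m)) (+-identityʳ _) ⟩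
      count (branch F x y) ∎
      where open ≡-Reasoning

  T′-branch-sizes : ∀ j a b → Cut′ j a b ≡ true → BranchSizes (Cut′ j) a b (level′ a b) (suc k) j
  T′-branch-sizes j = by-symmetry transport (left j)
    where
    transport : ∀ a b → (Cut′ j (exchange a) (exchange b) ≡ true →
        BranchSizes (Cut′ j) (exchange a) (exchange b) (level′ (exchange a) (exchange b)) (suc k) j) →
      Cut′ j a b ≡ true → BranchSizes (Cut′ j) a b (level′ a b) (suc k) j
    transport a b h e = BranchSizes-≃ exchangeₚ (Cut′-exchange j)
      (subst (λ ℓ → BranchSizes (Cut′ j) (exchange a) (exchange b) ℓ (suc k) j) (exchange-level a b)
        (h (trans (sym (Cut′-exchange j a b)) e)))
    at-level : ∀ {j a b ℓ ℓ′} → ℓ′ ≡ ℓ →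
      BranchSizes (Cut′ j) a b ℓ (suc k) j → BranchSizes (Cut′ j) a b ℓ′ (suc k) j
    at-level refl s = s
    left : ∀ j x b → Cut′ j (inl x) b ≡ true → BranchSizes (Cut′ j) (inl x) b (level′ (inl x) b) (suc k) j
    left zero x b e with copy b
    ... | in-left y = at-level (level′-ll x y) (BranchSizes-≃ idₚ Cut′-zero
          (branch-sizes-T′-ll x y (trans (sym (T′-ll x y)) (trans (sym (Cut′-zero (inl x) (inl y))) e))))
    ... | in-right y with cross-lr (trans (sym (Cut′-zero (inl x) (inr y))) e)
    ... | refl , refl = at-level (level′-lr r r) (BranchSizes-≃ idₚ Cut′-zero branch-sizes-bridge)
    left (suc j) x b e with copy b
    ... | in-right y = ⊥-elim (true≢false (trans (sym e) (Cut′-lr j x y)))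
    ... | in-left y with branch-sizes j x y (trans (sym (Cut′-ll j x y)) e)
    ... | branchSizes val comp = at-level (level′-ll x y)
          (branchSizes (subst (Valuation₂ (k ∸ level x y)) (sym (#branch x y)) val)
            (trans (cong₂ _+_ (#branch y x) (#branch x y)) comp))
      where
      #branch : ∀ x y → count (branch (Cut′ (suc j)) (inl x) (inl y)) ≡ count (branch (Cut G level j) x y)
      #branch = #branch-left-only (Cut G level j) (Cut′ (suc j)) (Cut′-ll j) (Cut′-lr j)

  extend : (Fin m → Fin m) → Fin (m + m) → Fin (m + m)
  extend τ u = [ (λ z → inl (τ z)) , inr ]′ (splitAt m u)

  extend-inl : ∀ τ z → extend τ (inl z) ≡ inl (τ z)
  extend-inl τ z rewrite splitAt-inl z = refl

  extend-inr : ∀ τ z → extend τ (inr z) ≡ inr z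
  extend-inr τ z rewrite splitAt-inr z = refl

  MirrorInvolution-inl : (F : Graph m) (F′ : Graph (m + m)) → (∀ a b → F′ (inl a) (inl b) ≡ F a b) →
    (∀ a b → F′ (inl a) (inr b) ≡ false) → (∀ a b → F′ (inr a) (inl b) ≡ false) → (∀ u → F′ u u ≡ false) →
    ∀ {x y} → MirrorInvolution F x y → MirrorInvolution F′ (inl x) (inl y)
  MirrorInvolution-inl F F′ F′-ll F′-lr F′-rl F′-irrefl {x} {y}
                       (mirrorInvolution τ inv aut fix swaps unique) =
    mirrorInvolution (extend τ) inv′ aut′ fix′ (trans (extend-inl τ x) (cong inl swaps)) unique′
    where
    inv′ : ∀ u → extend τ (extend τ u) ≡ u
    inv′ u with copy u
    ... | in-left z rewrite extend-inl τ z | extend-inl τ (τ z) | inv z = refl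
    ... | in-right z rewrite extend-inr τ z | extend-inr τ z = refl
    aut′ : ∀ u v → F′ (extend τ u) (extend τ v) ≡ F′ u v
    aut′ u v with copy u | copy v
    ... | in-left z | in-left w
      rewrite extend-inl τ z | extend-inl τ w | F′-ll (τ z) (τ w) | F′-ll z w = aut z w
    ... | in-left z | in-right w rewrite extend-inl τ z | extend-inr τ w | F′-lr (τ z) w | F′-lr z w = refl
    ... | in-right z | in-left w rewrite extend-inr τ z | extend-inl τ w | F′-rl z (τ w) | F′-rl z w = refl
    ... | in-right z | in-right w rewrite extend-inr τ z | extend-inr τ w = refl
    fix′ : ∀ w → reachable F′ (inl x) w ≡ false → extend τ w ≡ w
    fix′ w e with copy w
    ... | in-right z = extend-inr τ z
    ... | in-left z with reachable F x z in x~z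
    ... | true = ⊥-elim (true≢false (trans (sym (Walk⇒reachable
                   (walk-map inl (λ a b e′ → trans (F′-ll a b) e′) (reachable⇒Walk {F = F} x~z)))) e))
    ... | false = trans (extend-inl τ z) (cong inl (fix z x~z))
    unique′ : UniqueFlip F′ (extend τ) (inl x) (inl y)
    unique′ u v e₁ e₂ with copy u | copy v
    ... | in-left z | in-right w = ⊥-elim (true≢false (trans (sym e₁) (F′-lr z w)))
    ... | in-right z | in-left w = ⊥-elim (true≢false (trans (sym e₁) (F′-rl z w)))
    ... | in-right z | in-right w with inr-injective (trans (sym (extend-inr τ z)) e₂)
    ... | refl = ⊥-elim (true≢false (trans (sym e₁) (F′-irrefl (inr z))))
    unique′ u v e₁ e₂ | in-left z | in-left w
      with unique z w (trans (sym (F′-ll z w)) e₁) (inl-injective (trans (sym (extend-inl τ z)) e₂))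
    ... | inj₁ (p , q) = inj₁ (cong inl p , cong inl q)
    ... | inj₂ (p , q) = inj₂ (cong inl p , cong inl q)

  mirror-bridge : MirrorInvolution (Cut′ 0) (inl r) (inr r)
  mirror-bridge = mirrorInvolution exchange exchange-involutive
    (λ u v → sym (Cut′-exchange 0 u v)) fix (exchange-inl r) unique
    where
    fix : ∀ w → reachable (Cut′ 0) (inl r) w ≡ false → exchange w ≡ w
    fix w e = ⊥-elim (true≢false (trans (sym connected′) e))
      where
      connected′ = trans (reachable-≃ idₚ Cut′-zero (inl r) w) (T′-connected (inl r) w)
    unique : UniqueFlip (Cut′ 0) exchange (inl r) (inr r)
    unique u v e₁ e₂ with copy u
    ... | in-left z with trans (sym (exchange-inl z)) e₂
    ... | refl with cross-lr (trans (sym (Cut′-zero (inl z) (inr z))) e₁)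
    ... | refl , _ = inj₁ (refl , refl)
    unique u v e₁ e₂ | in-right z with trans (sym (exchange-inr z)) e₂
    ... | refl with cross-rl (trans (sym (Cut′-zero (inr z) (inl z))) e₁)
    ... | refl , _ = inj₂ (refl , refl)

  Cut′-irreflexive : ∀ j u → Cut′ j u u ≡ false
  Cut′-irreflexive j u rewrite T′-irreflexive u = refl

  T′-mirror : ∀ j a b → Cut′ j a b ≡ true → level′ a b ≡ suc j → MirrorInvolution (Cut′ j) a b
  T′-mirror j = by-symmetry transport (left j)
    where
    transport : ∀ a b → (Cut′ j (exchange a) (exchange b) ≡ true → level′ (exchange a) (exchange b) ≡ suc j →
        MirrorInvolution (Cut′ j) (exchange a) (exchange b)) →
      Cut′ j a b ≡ true → level′ a b ≡ suc j → MirrorInvolution (Cut′ j) a b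
    transport a b h e l = MirrorInvolution-≃ exchangeₚ (Cut′-exchange j)
      (h (trans (sym (Cut′-exchange j a b)) e) (trans (exchange-level a b) l))
    left : ∀ j x b → Cut′ j (inl x) b ≡ true → level′ (inl x) b ≡ suc j → MirrorInvolution (Cut′ j) (inl x) b
    left zero x b e l with copy b
    ... | in-left y = ⊥-elim (<⇒≢ (level≥1 x y Gxy) (sym (suc-injective (trans (sym (level′-ll x y)) l))))
      where
      Gxy : G x y ≡ true
      Gxy = trans (sym (T′-ll x y)) (trans (sym (Cut′-zero (inl x) (inl y))) e)
    ... | in-right y with cross-lr (trans (sym (Cut′-zero (inl x) (inr y))) e)
    ... | refl , refl = mirror-bridge
    left (suc j) x b e l with copy b
    ... | in-right y = ⊥-elim (true≢false (trans (sym e) (Cut′-lr j x y)))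
    ... | in-left y = MirrorInvolution-inl (Cut G level j) (Cut′ (suc j)) (Cut′-ll j) (Cut′-lr j) (Cut′-rl j)
          (Cut′-irreflexive (suc j))
          (mirror j x y (trans (sym (Cut′-ll j x y)) e) (suc-injective (trans (sym (level′-ll x y)) l)))

  doubled : LevelledTree T′ (suc k)
  doubled = record
    { size = m+m≡2^1+k
    ; level = level′
    ; symmetric = T′-symmetric
    ; irreflexive = T′-irreflexive
    ; level-sym = level′-sym
    ; level≥1 = level′≥1
    ; level≤k = level′≤
    ; connected = T′-connected
    ; branches-complementary = T′-branches-complementary
    ; mirror = T′-mirror
    ; branch-sizes = T′-branch-sizes
    }

levelled : ∀ {n} {G : Graph n} → RBM n G → ∃ λ k → LevelledTree G k
levelled (rbm-one G edgeless) = 0 , LevelledTree-one G edgeless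
levelled (rbm-dbl {G = G} rbm r) with levelled rbm
... | k , L = suc k , Doubling.doubled G r L
levelled (rbm-iso rbm π H≃G) with levelled rbm
... | k , L = k , LevelledTree-≃ π H≃G L

-- The recursive cutting of a levelled tree

reversedCount-cong : ∀ {n} {F F′ : Graph n} → (∀ u v → F u v ≡ F′ u v) → (π : Permutation′ n) →
  reversedCount F π ≡ reversedCount F′ π
reversedCount-cong {F = F} {F′} F≗F′ π = trans (reversedCount≡∑² F π)
  (trans (∑²-cong (λ u v → cong (λ z → 𝟙 (z ∧ _)) (F≗F′ u v))) (sym (reversedCount≡∑² F′ π)))

swapped-branches : ∀ {n} (F : Graph n) (π : Permutation′ n) → IsAut F π → ∀ {a b} →
  π ⟨$⟩ʳ a ≡ b → π ⟨$⟩ʳ b ≡ a → count (branch F b a) ≡ count (branch F a b)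
swapped-branches F π π-aut {a} {b} πa≡b πb≡a = count-permute π _ _ (λ x →
  trans (branch-≃ π (λ u v → sym (π-aut u v)) b a x) (cong₂ (λ a′ b′ → branch F a′ b′ (π ⟨$⟩ʳ x)) πb≡a πa≡b))

module Cutting {k} {T : Graph (2 ^ k)} (L : LevelledTree T k) where
  open LevelledTree L

  C : ℕ → Graph (2 ^ k)
  C = Cut T level

  C-sym : ∀ j u v → C j u v ≡ C j v u
  C-sym = Cut-sym T level symmetric level-sym

  next-level-mirror-bridge : ∀ (F : Graph (2 ^ k)) j → (∀ a b → F a b ≡ C j a b) →
    ∀ a b → C j a b ≡ true → level a b ≡ suc j → OddComp F a × MirrorBridge F a b
  next-level-mirror-bridge F j F≗C a b e l with mirror j a b e l
  ... | mirrorInvolution τ inv aut fix swaps unique =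
    (σ , component-aut , trans (cong (_% 2) (reversedCount-cong F≗C σ)) odd) ,
    (trans (F≗C a b) e , σ , component-aut , swaps , trans (cong τ (sym swaps)) (inv a))
    where
    σ : Permutation′ (2 ^ k)
    σ = involution τ inv
    component-aut : IsCompAut F a σ
    component-aut = (λ u v → trans (F≗C _ _) (trans (aut u v) (sym (F≗C u v)))) ,
                    (λ w e′ → fix w (trans (reachable-≃ idₚ (λ x y → sym (F≗C x y)) a w) e′))
    a≢b : a ≢ b
    a≢b refl = true≢false (trans (sym (Cut⊆ T level j a a e)) (irreflexive a))
    odd : reversedCount (C j) σ % 2 ≡ 1
    odd = ReversalParity.odd-if-one-flipped (C j) τ inv (C-sym j) aut
            (ReversalParity.one-flipped (C j) τ inv (C-sym j) aut a b e swaps a≢b unique)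

  -- A mirror-bridge halves its component, whose size 2^(k - j) has a larger 2-adic
  -- valuation than the branch of an edge of level at least j + 2.
  deeper-edge-not-mirror-bridge : ∀ (F : Graph (2 ^ k)) j → (∀ a b → F a b ≡ C j a b) →
    ∀ a b → C j a b ≡ true → suc (suc j) ≤ level a b → ¬ MirrorBridge F a b
  deeper-edge-not-mirror-bridge F j F≗C a b e 2+j≤ℓ (_ , π , (π-aut , _) , πa≡b , πb≡a)
    with branch-sizes j a b e
  ... | branchSizes val comp = <⇒≢ (∸-monoʳ-< 2+j≤ℓ ℓ≤k) (Valuation₂-unique val half-valuation)
    where
    ℓ≤k : level a b ≤ k
    ℓ≤k = level≤k a b (Cut⊆ T level j a b e)
    1+j≤k : suc j ≤ k
    1+j≤k = ≤-trans (n≤1+n (suc j)) (≤-trans 2+j≤ℓ ℓ≤k)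
    π-aut′ : IsAut (C j) π
    π-aut′ u v = trans (sym (F≗C _ _)) (trans (π-aut u v) (F≗C u v))
    x = count (branch (C j) a b)
    x+x≡ : x + x ≡ 2 ^ suc (k ∸ suc j)
    x+x≡ = begin
      x + x                         ≡⟨ cong (_+ x) (sym (swapped-branches (C j) π π-aut′ πa≡b πb≡a)) ⟩
      count (branch (C j) b a) + x  ≡⟨ comp ⟩
      2 ^ (k ∸ j)                   ≡⟨ cong (2 ^_) (+-∸-assoc 1 1+j≤k) ⟩
      2 ^ suc (k ∸ suc j)           ∎
      where open ≡-Reasoning
    half-valuation : Valuation₂ (k ∸ suc j) x
    half-valuation =
      subst (Valuation₂ (k ∸ suc j)) (sym (half-2^ {k ∸ suc j} x+x≡)) (Valuation₂-2^ (k ∸ suc j))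

  branch-valuation : ∀ u v → T u v ≡ true → Valuation₂ (k ∸ level u v) (branchSize T u v)
  branch-valuation u v e with branch-sizes 0 u v (<⇒Cut T level 0 u v e (level≥1 u v e))
  ... | branchSizes val _ = subst (Valuation₂ (k ∸ level u v)) (sym #branch) val
    where
    #branch : branchSize T u v ≡ count (branch (C 0) u v)
    #branch = trans (countV≡count (branch T u v))
      (count-permute idₚ _ _ (branch-≃ idₚ (λ x y → sym (Cut-zero T level level≥1 x y)) u v))

  module _ (Ts : ℕ → Graph (2 ^ k)) (Ts₀≗T : ∀ u v → Ts 0 u v ≡ T u v)
           (steps : ∀ i → suc i ≤ k → CutStep (Ts i) (Ts (suc i))) where

    cutting≗C : ∀ j → j ≤ k → ∀ a b → Ts j a b ≡ C j a b
    cutting≗C zero _ a b = trans (Ts₀≗T a b) (sym (Cut-zero T level level≥1 a b))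
    cutting≗C (suc j) 1+j≤k a b = bool-ext kept⇒ ⇒kept
      where
      Tsⱼ≗C : ∀ a b → Ts j a b ≡ C j a b
      Tsⱼ≗C = cutting≗C j (≤-trans (n≤1+n j) 1+j≤k)
      step = steps j 1+j≤k a b
      kept⇒ : Ts (suc j) a b ≡ true → C (suc j) a b ≡ true
      kept⇒ e with proj₁ step e
      ... | in-Tsⱼ , not-cut = <⇒Cut T level (suc j) a b (Cut⊆ T level j a b in-Cⱼ) 1+j<ℓ
        where
        in-Cⱼ = trans (sym (Tsⱼ≗C a b)) in-Tsⱼ
        1+j<ℓ : suc j < level a b
        1+j<ℓ with <-cmp (suc j) (level a b)
        ... | tri< 1+j<ℓ _ _ = 1+j<ℓ
        ... | tri≈ _ 1+j≡ℓ _ =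
          ⊥-elim (not-cut (next-level-mirror-bridge (Ts j) j Tsⱼ≗C a b in-Cⱼ (sym 1+j≡ℓ)))
        ... | tri> _ _ ℓ<1+j = ⊥-elim (<⇒≱ (Cut⇒< T level j a b in-Cⱼ) (≤-pred ℓ<1+j))
      ⇒kept : C (suc j) a b ≡ true → Ts (suc j) a b ≡ true
      ⇒kept e = proj₂ step (trans (Tsⱼ≗C a b) in-Cⱼ ,
        λ { (_ , bridge) → deeper-edge-not-mirror-bridge (Ts j) j Tsⱼ≗C a b in-Cⱼ 1+j<ℓ bridge })
        where
        1+j<ℓ = Cut⇒< T level (suc j) a b e
        in-Cⱼ = <⇒Cut T level j a b (Cut⊆ T level (suc j) a b e) (<-trans (n<1+n j) 1+j<ℓ)

    removed-branch-valuation : ∀ j → suc j ≤ k → ∀ u v → Ts j u v ≡ true → Ts (suc j) u v ≡ false →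
      Valuation₂ (k ∸ suc j) (branchSize T u v)
    removed-branch-valuation j 1+j≤k u v kept removed =
      subst (λ ℓ → Valuation₂ (k ∸ ℓ) (branchSize T u v)) (level≡ (<-cmp (level u v) (suc j)))
        (branch-valuation u v (Cut⊆ T level j u v in-Cⱼ))
      where
      in-Cⱼ : C j u v ≡ true
      in-Cⱼ = trans (sym (cutting≗C j (≤-trans (n≤1+n j) 1+j≤k) u v)) kept
      level≡ : Tri (level u v < suc j) (level u v ≡ suc j) (suc j < level u v) → level u v ≡ suc j
      level≡ (tri≈ _ ℓ≡1+j _) = ℓ≡1+j
      level≡ (tri< ℓ<1+j _ _) = ⊥-elim (<⇒≱ (Cut⇒< T level j u v in-Cⱼ) (≤-pred ℓ<1+j))
      level≡ (tri> _ _ 1+j<ℓ) = ⊥-elim (true≢false (trans (sym in-C₁₊ⱼ)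
        (trans (sym (cutting≗C (suc j) 1+j≤k u v)) removed)))
        where
        in-C₁₊ⱼ = <⇒Cut T level (suc j) u v (Cut⊆ T level j u v in-Cⱼ) 1+j<ℓ

lemma7p2 : (k : ℕ) (T : Graph (2 ^ k)) → RBM (2 ^ k) T →
    (Ts : ℕ → Graph (2 ^ k)) → (∀ u v → Ts 0 u v ≡ T u v) →
    (∀ i → suc i ≤ k → CutStep (Ts i) (Ts (suc i))) →
    ∀ i → 1 ≤ i → i ≤ k → (u v : Fin (2 ^ k)) →
    Ts (i ∸ 1) u v ≡ true → Ts i u v ≡ false →
    (2 ^ (k ∸ i) ∣ branchSize T u v) × ¬ (2 ^ suc (k ∸ i) ∣ branchSize T u v)
lemma7p2 k T rbm Ts Ts₀≗T steps (suc j) _ 1+j≤k u v kept removed with levelled rbm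
... | k′ , L with 2^-injective {k} {k′} (LevelledTree.size L)
... | refl = Valuation₂⇒∣ {k ∸ suc j} valuation , Valuation₂⇒∤ {k ∸ suc j} valuation
  where
  valuation : Valuation₂ (k ∸ suc j) (branchSize T u v)
  valuation = Cutting.removed-branch-valuation L Ts Ts₀≗T steps j 1+j≤k u v kept removed
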